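{- There exists an absolute constant $C>0$ such that the following holds. Let $n,k$ be positive integers, $\alpha\in[0,1]$, and let $\mathcal{F}\subseteq 2^{[n]}$ be a family of size $2^{\alpha n}$. If $F_1,\dots,F_k$ are elements of $\mathcal{F}$ chosen independently and uniformly at random, then $$\mathbb{E}\Big[\Big|\bigcup_{i=1}^k F_i\Big|\Big]\geq \alpha n-\frac{Cn}{2^k}.$$
   Context: $2^{[n]}$ denotes the family of all subsets of $[n]$. (In the paper, $C$ is the constant for which $H(p)\leq 1-(1-p)^k+C/2^k$ holds for all $k\ge1$, $p\in[0,1]$, $H$ the binary entropy.) -}

module Defs where

open import Data.Nat using (ℕ; zero; suc)
open import Data.List using (List; []; _∷_; [_]; map; concatMap; foldr)
open import Data.Nat.ListAction using (sum)
open import Data.Fin.Subset using (Subset; _∪_; ⊥; ∣_∣)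

tuples : {A : Set} → List A → ℕ → List (List A)
tuples xs zero    = [ [] ]
tuples xs (suc k) = concatMap (λ x → map (x ∷_) (tuples xs k)) xs

unionAll : {n : ℕ} → List (Subset n) → Subset n
unionAll = foldr _∪_ ⊥

-- Σ over all k-tuples of |F₁ ∪ … ∪ F_k|  (= |𝓕|^k · 𝔼|⋃ Fᵢ|).
totalUnion : {n : ℕ} → List (Subset n) → ℕ → ℕ
totalUnion 𝓕 k = sum (map (λ t → ∣ unionAll t ∣) (tuples 𝓕 k))

-- Let m = |𝓕| and let cᵢ be the number of members of 𝓕 missing the point i. A k-tuple covers i
-- unless all of its members miss i, so the sum over k-tuples of |F₁ ∪ … ∪ F_k| is n mᵏ − Σᵢ cᵢᵏ.
-- By subadditivity of entropy log₂ m ≤ Σᵢ H(cᵢ / m), so it suffices to prove the one-variable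
-- inequality H(q) + qᵏ ≤ 1 + C / 2ᵏ. Without real numbers, every inequality between logarithms is
-- stated between powers of natural numbers. Subadditivity is proved by induction on n, splitting 𝓕
-- by its first point; the two halves are recombined with the convexity of x ↦ xᵏ. The one-variable
-- inequality follows from Gibbs' inequality with weights adapted to three regimes: q ≤ 1/2 + 1/8k,
-- where qᵏ = O(2⁻ᵏ) and H ≤ 1 suffices; 1/2 + 1/8k < q ≤ 7/8; and q > 7/8, on dyadic scales of 1 − q.

module Submission where

open import Data.Bool using (Bool; true; false; _∧_; _∨_; not)
open import Data.Bool.ListAction using (all; any)
open import Data.Empty using (⊥-elim)
open import Data.Fin.Subset using (Subset; ∣_∣)
open import Data.List using (List; []; _∷_; map; concatMap; length; _++_; replicate)
open import Data.List.Properties using (length-++; length-replicate; map-++; length-map)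
open import Data.List.Relation.Unary.All using (All; []; _∷_)
open import Data.List.Relation.Unary.AllPairs using ([]; _∷_)
open import Data.List.Relation.Unary.Unique.Propositional using (Unique)
open import Data.Nat
open import Data.Nat.DivMod using (_/_; _%_; m≡m%n+[m/n]*n; m%n<n; m/n*n≤m; m≥n⇒m/n>0)
open import Data.Nat.ListAction using (sum; product)
open import Data.Nat.ListAction.Properties using (sum-++; product-++)
open import Data.Nat.Properties
open import Data.Nat.Tactic.RingSolver using (solve-∀)
open import Data.Product using (Σ; _×_; _,_; proj₁; proj₂; map₁; map₂)
open import Data.Sum using (inj₁; inj₂)
open import Data.Unit using (tt)
open import Data.Vec as Vec using (Vec; []; _∷_; head; tail; zipWith)
open import Data.Vec.Properties using (zipWith-assoc; zipWith-identityˡ; zipWith-identityʳ)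
open import Function using (_∘_)
open import Relation.Binary.PropositionalEquality using (_≡_; _≢_; refl; sym; trans; cong; cong₂; subst; subst₂)
open import Relation.Nullary using (yes; no)
import Algebra.Properties.CommutativeSemigroup +-commutativeSemigroup as +-CS
import Algebra.Properties.CommutativeSemigroup *-commutativeSemigroup as *-CS
open import Defs
open ≤-Reasoning

^-distribʳ-* : ∀ m n o → (m * n) ^ o ≡ m ^ o * n ^ o
^-distribʳ-* m n zero    = refl
^-distribʳ-* m n (suc o) = begin-equality
  m * n * (m * n) ^ o        ≡⟨ cong (m * n *_) (^-distribʳ-* m n o) ⟩
  m * n * (m ^ o * n ^ o)    ≡⟨ *-CS.interchange m n (m ^ o) (n ^ o) ⟩
  m * m ^ o * (n * n ^ o)    ∎

m+n≢0 : ∀ m n .{{_ : NonZero m}} → NonZero (m + n)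
m+n≢0 m n = >-nonZero (≤-trans (>-nonZero⁻¹ m) (m≤m+n m n))

^-cancelˡ-≤ : ∀ n .{{_ : NonZero n}} {x y} → x ^ n ≤ y ^ n → x ≤ y
^-cancelˡ-≤ n {x} {y} xⁿ≤yⁿ with x ≤? y
... | yes x≤y = x≤y
... | no x≰y  = ⊥-elim (<⇒≱ (^-monoˡ-< n (≰⇒> x≰y)) xⁿ≤yⁿ)

^-rearrangement-+ : ∀ j x d → x ^ j * (x + d) + x * (x + d) ^ j ≤ x ^ suc j + (x + d) ^ suc j
^-rearrangement-+ j x d = begin
    x ^ j * (x + d) + x * (x + d) ^ j
  ≡⟨ expand x (x ^ j) ((x + d) ^ j) d ⟩
    x * x ^ j + x * (x + d) ^ j + x ^ j * d
  ≤⟨ +-monoʳ-≤ (x * x ^ j + x * (x + d) ^ j) (*-monoˡ-≤ d (^-monoˡ-≤ j (m≤m+n x d))) ⟩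
    x * x ^ j + x * (x + d) ^ j + (x + d) ^ j * d
  ≡⟨ collect x ((x + d) ^ j) (x * x ^ j) d ⟩
    x * x ^ j + (x + d) * (x + d) ^ j
  ∎
  where
    expand : ∀ x A B d → A * (x + d) + x * B ≡ x * A + x * B + A * d
    expand = solve-∀
    collect : ∀ x B C d → C + x * B + B * d ≡ C + (x + d) * B
    collect = solve-∀

^-rearrangement : ∀ j x y → x ^ j * y + x * y ^ j ≤ x ^ suc j + y ^ suc j
^-rearrangement j x y with ≤-total x y
... | inj₁ x≤y rewrite sym (m+[n∸m]≡n x≤y) = ^-rearrangement-+ j x (y ∸ x)
... | inj₂ y≤x rewrite sym (m+[n∸m]≡n y≤x) = begin
    (y + d) ^ j * y + (y + d) * y ^ j   ≡⟨ swap (y ^ j) ((y + d) ^ j) y (y + d) ⟩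
    y ^ j * (y + d) + y * (y + d) ^ j   ≤⟨ ^-rearrangement-+ j y d ⟩
    y ^ suc j + (y + d) ^ suc j         ≡⟨ +-comm (y ^ suc j) _ ⟩
    (y + d) ^ suc j + y ^ suc j         ∎
  where
    d = x ∸ y
    swap : ∀ A B y z → B * y + z * A ≡ A * z + y * B
    swap = solve-∀

amgm-two-point : ∀ N u v → suc N * u * v ^ N ≤ u ^ suc N + N * v ^ suc N
amgm-two-point zero    u v = ≤-reflexive (base u)
  where
    base : ∀ u → (u + 0) * 1 ≡ u * 1 + 0
    base = solve-∀
amgm-two-point (suc N) u v = begin
    (2 + N) * u * (v * v ^ N)
  ≡⟨ split N u v (v ^ N) ⟩
    (suc N * u * v ^ N) * v + u * (v * v ^ N)
  ≤⟨ +-monoˡ-≤ _ (*-monoˡ-≤ v (amgm-two-point N u v)) ⟩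
    (u ^ suc N + N * v ^ suc N) * v + u * (v * v ^ N)
  ≡⟨ regroup N u v (u ^ N) (v ^ N) ⟩
    N * (v * (v * v ^ N)) + ((u * u ^ N) * v + u * (v * v ^ N))
  ≤⟨ +-monoʳ-≤ (N * (v * (v * v ^ N))) (^-rearrangement (suc N) u v) ⟩
    N * (v * (v * v ^ N)) + (u * (u * u ^ N) + v * (v * v ^ N))
  ≡⟨ collect N u v (u ^ N) (v ^ N) ⟩
    u * (u * u ^ N) + suc N * (v * (v * v ^ N))
  ∎
  where
    split : ∀ N u v V → (2 + N) * u * (v * V) ≡ (suc N * u * V) * v + u * (v * V)
    split = solve-∀
    regroup : ∀ N u v U V → (u * U + N * (v * V)) * v + u * (v * V) ≡ N * (v * (v * V)) + ((u * U) * v + u * (v * V))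
    regroup = solve-∀
    collect : ∀ N u v U V → N * (v * (v * V)) + (u * (u * U) + v * (v * V)) ≡ u * (u * U) + suc N * (v * (v * V))
    collect = solve-∀

amgm-step : ∀ n S x → suc n ^ suc n * S ^ n * x ≤ n ^ n * (S + x) ^ suc n
amgm-step zero    S x = begin
  1 * x              ≡⟨ *-identityˡ x ⟩
  x                  ≤⟨ m≤n+m x S ⟩
  S + x              ≡⟨ sym (trans (*-identityˡ _) (*-identityʳ _)) ⟩
  1 * ((S + x) * 1)  ∎
amgm-step n@(suc _) S x = *-cancelˡ-≤ n (+-cancelʳ-≤ (n * (suc n * S * (A * B))) _ _ (begin
    n * ((suc n * A) * B * x) + n * (suc n * S * (A * B))
  ≡⟨ lhs n S x A B ⟩
    suc n * (n * (S + x)) * (A * B)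
  ≡⟨ cong (suc n * (n * (S + x)) *_) (sym (^-distribʳ-* (suc n) S n)) ⟩
    suc n * (n * (S + x)) * (suc n * S) ^ n
  ≤⟨ amgm-two-point n (n * (S + x)) (suc n * S) ⟩
    (n * (S + x)) ^ suc n + n * (suc n * S) ^ suc n
  ≡⟨ cong₂ _+_ (trans (cong (n * (S + x) *_) (^-distribʳ-* n (S + x) n)) (rhs n S x (n ^ n) ((S + x) ^ n)))
               (cong (λ z → n * (suc n * S * z)) (^-distribʳ-* (suc n) S n)) ⟩
    n * (n ^ n * ((S + x) * (S + x) ^ n)) + n * (suc n * S * (A * B))
  ∎))
  where
    A = suc n ^ n
    B = S ^ n
    lhs : ∀ n S x A B → n * ((suc n * A) * B * x) + n * (suc n * S * (A * B)) ≡ suc n * (n * (S + x)) * (A * B)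
    lhs = solve-∀
    rhs : ∀ n S x E Q → n * (S + x) * (E * Q) ≡ n * (E * ((S + x) * Q))
    rhs = solve-∀

nⁿ≢0 : ∀ n → NonZero (n ^ n)
nⁿ≢0 zero    = _
nⁿ≢0 (suc n) = m^n≢0 (suc n) (suc n)

amgm : ∀ xs → length xs ^ length xs * product xs ≤ sum xs ^ length xs
amgm []       = ≤-refl
amgm (x ∷ xs) = *-cancelˡ-≤ (n ^ n) {{nⁿ≢0 n}} (begin
    n ^ n * (suc n ^ suc n * (x * P))
  ≡⟨ shuffle (n ^ n) (suc n ^ suc n) x P ⟩
    suc n ^ suc n * x * (n ^ n * P)
  ≤⟨ *-monoʳ-≤ (suc n ^ suc n * x) (amgm xs) ⟩
    suc n ^ suc n * x * S ^ n
  ≡⟨ *-CS.xy∙z≈xz∙y (suc n ^ suc n) x (S ^ n) ⟩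
    suc n ^ suc n * S ^ n * x
  ≤⟨ amgm-step n S x ⟩
    n ^ n * (S + x) ^ suc n
  ≡⟨ cong (λ z → n ^ n * z ^ suc n) (+-comm S x) ⟩
    n ^ n * (x + S) ^ suc n
  ∎)
  where
    n = length xs
    S = sum xs
    P = product xs
    shuffle : ∀ E F x P → E * (F * (x * P)) ≡ F * x * (E * P)
    shuffle = solve-∀

sum-replicate : ∀ a x → sum (replicate a x) ≡ a * x
sum-replicate zero    x = refl
sum-replicate (suc a) x = cong (x +_) (sum-replicate a x)

product-replicate : ∀ a x → product (replicate a x) ≡ x ^ a
product-replicate zero    x = refl
product-replicate (suc a) x = cong (x *_) (product-replicate a x)

weighted-amgm : ∀ a b x y → (a + b) ^ (a + b) * (x ^ a * y ^ b) ≤ (a * x + b * y) ^ (a + b)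
weighted-amgm a b x y = subst₂ _≤_ lhs rhs (amgm xs)
  where
    xs = replicate a x ++ replicate b y
    len : length xs ≡ a + b
    len = trans (length-++ (replicate a x)) (cong₂ _+_ (length-replicate a) (length-replicate b))
    lhs : length xs ^ length xs * product xs ≡ (a + b) ^ (a + b) * (x ^ a * y ^ b)
    lhs = cong₂ (λ l p → l ^ l * p) len
            (trans (product-++ (replicate a x) _) (cong₂ _*_ (product-replicate a x) (product-replicate b y)))
    rhs : sum xs ^ length xs ≡ (a * x + b * y) ^ (a + b)
    rhs = cong₂ _^_ (trans (sum-++ (replicate a x) _) (cong₂ _+_ (sum-replicate a x) (sum-replicate b y))) len

gibbs : ∀ a b α β .{{_ : NonZero a}} .{{_ : NonZero b}} →
        (a + b) ^ (a + b) * (α ^ a * β ^ b) ≤ (α + β) ^ (a + b) * (a ^ a * b ^ b)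
gibbs a b α β = *-cancelʳ-≤ _ _ (a ^ b * b ^ a) {{m*n≢0 (a ^ b) (b ^ a) {{m^n≢0 a b}} {{m^n≢0 b a}}}} (begin
    (a + b) ^ (a + b) * (α ^ a * β ^ b) * (a ^ b * b ^ a)
  ≡⟨ shuffle ((a + b) ^ (a + b)) (α ^ a) (β ^ b) (a ^ b) (b ^ a) ⟩
    (a + b) ^ (a + b) * ((b ^ a * α ^ a) * (a ^ b * β ^ b))
  ≡⟨ cong ((a + b) ^ (a + b) *_) (sym (cong₂ _*_ (^-distribʳ-* b α a) (^-distribʳ-* a β b))) ⟩
    (a + b) ^ (a + b) * ((b * α) ^ a * (a * β) ^ b)
  ≤⟨ weighted-amgm a b (b * α) (a * β) ⟩
    (a * (b * α) + b * (a * β)) ^ (a + b)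
  ≡⟨ cong (_^ (a + b)) (factor a b α β) ⟩
    (a * b * (α + β)) ^ (a + b)
  ≡⟨ trans (^-distribʳ-* (a * b) (α + β) (a + b)) (cong (_* (α + β) ^ (a + b)) (^-distribʳ-* a b (a + b))) ⟩
    a ^ (a + b) * b ^ (a + b) * (α + β) ^ (a + b)
  ≡⟨ cong₂ (λ u v → u * v * (α + β) ^ (a + b)) (^-distribˡ-+-* a a b) (^-distribˡ-+-* b a b) ⟩
    a ^ a * a ^ b * (b ^ a * b ^ b) * (α + β) ^ (a + b)
  ≡⟨ regroup (a ^ a) (a ^ b) (b ^ a) (b ^ b) ((α + β) ^ (a + b)) ⟩
    (α + β) ^ (a + b) * (a ^ a * b ^ b) * (a ^ b * b ^ a)
  ∎)
  where
    shuffle : ∀ M A B C D → M * (A * B) * (C * D) ≡ M * ((D * A) * (C * B))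
    shuffle = solve-∀
    factor : ∀ a b α β → a * (b * α) + b * (a * β) ≡ a * b * (α + β)
    factor = solve-∀
    regroup : ∀ P Q R S T → P * Q * (R * S) * T ≡ T * (P * S) * (Q * R)
    regroup = solve-∀

power-mean : ∀ k a b x y → (a * x + b * y) ^ suc k ≤ (a + b) ^ k * (a * x ^ suc k + b * y ^ suc k)
power-mean zero    a b x y = ≤-reflexive (base a b x y)
  where
    base : ∀ a b x y → (a * x + b * y) * 1 ≡ 1 * (a * (x * 1) + b * (y * 1))
    base = solve-∀
power-mean (suc k) a b x y = begin
    (a * x + b * y) * (a * x + b * y) ^ suc k
  ≤⟨ *-monoʳ-≤ (a * x + b * y) (power-mean k a b x y) ⟩
    (a * x + b * y) * ((a + b) ^ k * (a * x ^ suc k + b * y ^ suc k))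
  ≡⟨ expand a b x y ((a + b) ^ k) (x ^ k) (y ^ k) ⟩
    (a + b) ^ k * (a * a * x ^ suc (suc k) + b * b * y ^ suc (suc k) + a * b * (x ^ suc k * y + x * y ^ suc k))
  ≤⟨ *-monoʳ-≤ ((a + b) ^ k) (+-monoʳ-≤ (a * a * x ^ suc (suc k) + b * b * y ^ suc (suc k))
                                         (*-monoʳ-≤ (a * b) (^-rearrangement (suc k) x y))) ⟩
    (a + b) ^ k * (a * a * x ^ suc (suc k) + b * b * y ^ suc (suc k) + a * b * (x ^ suc (suc k) + y ^ suc (suc k)))
  ≡⟨ collect a b ((a + b) ^ k) (x ^ suc (suc k)) (y ^ suc (suc k)) ⟩
    (a + b) * (a + b) ^ k * (a * x ^ suc (suc k) + b * y ^ suc (suc k))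
  ∎
  where
    expand : ∀ a b x y M X Y → (a * x + b * y) * (M * (a * (x * X) + b * (y * Y)))
                               ≡ M * (a * a * (x * (x * X)) + b * b * (y * (y * Y)) + a * b * ((x * X) * y + x * (y * Y)))
    expand = solve-∀
    collect : ∀ a b M U V → M * (a * a * U + b * b * V + a * b * (U + V)) ≡ (a + b) * M * (a * U + b * V)
    collect = solve-∀

bernoulli : ∀ L u d → u ^ suc L + suc L * d * u ^ L ≤ (u + d) ^ suc L
bernoulli zero    u d = ≤-reflexive (base u d)
  where
    base : ∀ u d → u * 1 + (d + 0) * 1 ≡ (u + d) * 1
    base = solve-∀
bernoulli (suc L) u d = begin
    u * (u * u ^ L) + (2 + L) * d * (u * u ^ L)
  ≤⟨ m≤m+n _ (d * (suc L * d * u ^ L)) ⟩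
    u * (u * u ^ L) + (2 + L) * d * (u * u ^ L) + d * (suc L * d * u ^ L)
  ≡⟨ factor L u d (u ^ L) ⟩
    (u + d) * (u * u ^ L + suc L * d * u ^ L)
  ≤⟨ *-monoʳ-≤ (u + d) (bernoulli L u d) ⟩
    (u + d) * (u + d) ^ suc L
  ∎
  where
    factor : ∀ L u d U → u * (u * U) + (2 + L) * d * (u * U) + d * (suc L * d * U) ≡ (u + d) * (u * U + suc L * d * U)
    factor = solve-∀

^-mean-value : ∀ L u d → (u + d) ^ suc L ≤ u ^ suc L + suc L * d * (u + d) ^ L
^-mean-value zero    u d = ≤-reflexive (base u d)
  where
    base : ∀ u d → (u + d) * 1 ≡ u * 1 + (d + 0) * 1
    base = solve-∀
^-mean-value (suc L) u d = begin
    (u + d) * W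
  ≡⟨ *-distribʳ-+ W u d ⟩
    u * W + d * W
  ≤⟨ +-monoˡ-≤ (d * W) (*-monoʳ-≤ u (^-mean-value L u d)) ⟩
    u * (u ^ suc L + suc L * d * (u + d) ^ L) + d * W
  ≡⟨ cong (_+ d * W) (expand L u d (u ^ L) ((u + d) ^ L)) ⟩
    u * u ^ suc L + suc L * d * (u * (u + d) ^ L) + d * W
  ≤⟨ +-monoˡ-≤ (d * W) (+-monoʳ-≤ (u * u ^ suc L)
       (*-monoʳ-≤ (suc L * d) (*-monoˡ-≤ ((u + d) ^ L) (m≤m+n u d)))) ⟩
    u * u ^ suc L + suc L * d * W + d * W
  ≡⟨ collect L u d (u * u ^ suc L) W ⟩
    u * u ^ suc L + (2 + L) * d * W
  ∎
  where
    W = (u + d) ^ suc L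
    expand : ∀ L u d U V → u * (u * U + suc L * d * V) ≡ u * (u * U) + suc L * d * (u * V)
    expand = solve-∀
    collect : ∀ L u d A W → A + suc L * d * W + d * W ≡ A + (2 + L) * d * W
    collect = solve-∀

[u+d]^j≤2u^j : ∀ j u d → 2 * j * d ≤ u + d → (u + d) ^ j ≤ 2 * u ^ j
[u+d]^j≤2u^j zero    u d _ = s≤s z≤n
[u+d]^j≤2u^j (suc L) u d small = +-cancelʳ-≤ ((u + d) ^ suc L) _ _ (begin
    (u + d) ^ suc L + (u + d) ^ suc L
  ≤⟨ +-mono-≤ (^-mean-value L u d) (^-mean-value L u d) ⟩
    (u ^ suc L + T) + (u ^ suc L + T)
  ≡⟨ double (u ^ suc L) L d ((u + d) ^ L) ⟩
    2 * u ^ suc L + 2 * suc L * d * (u + d) ^ L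
  ≤⟨ +-monoʳ-≤ (2 * u ^ suc L) (*-monoˡ-≤ ((u + d) ^ L) small) ⟩
    2 * u ^ suc L + (u + d) ^ suc L
  ∎)
  where
    T = suc L * d * (u + d) ^ L
    double : ∀ A L d X → (A + suc L * d * X) + (A + suc L * d * X) ≡ 2 * A + 2 * suc L * d * X
    double = solve-∀

^-^-reassoc : ∀ u p q r s → p * q ≡ r * s → (u ^ p) ^ q ≡ (u ^ r) ^ s
^-^-reassoc u p q r s pq≡rs = trans (^-*-assoc u p q) (trans (cong (u ^_) pq≡rs) (sym (^-*-assoc u r s)))

2M^[1+n]≤[M+x]^[1+n] : ∀ n M x → M ≤ suc n * x → 2 * M ^ suc n ≤ (M + x) ^ suc n
2M^[1+n]≤[M+x]^[1+n] n M x M≤[1+n]x = begin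
    2 * M ^ suc n                     ≡⟨ double M (M ^ n) ⟩
    M ^ suc n + M * M ^ n             ≤⟨ +-monoʳ-≤ (M ^ suc n) (*-monoˡ-≤ (M ^ n) M≤[1+n]x) ⟩
    M ^ suc n + suc n * x * M ^ n     ≤⟨ bernoulli n M x ⟩
    (M + x) ^ suc n                   ∎
  where
    double : ∀ M P → 2 * (M * P) ≡ M * P + M * P
    double = solve-∀

m<[m/n]*n+n : ∀ m n .{{_ : NonZero n}} → m < (m / n) * n + n
m<[m/n]*n+n m n = begin-strict
  m                      ≡⟨ m≡m%n+[m/n]*n m n ⟩
  m % n + (m / n) * n    <⟨ +-monoˡ-< ((m / n) * n) (m%n<n m n) ⟩
  n + (m / n) * n        ≡⟨ +-comm n _ ⟩
  (m / n) * n + n        ∎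

m<n*[1+m/n] : ∀ m n .{{_ : NonZero n}} → m < n * suc (m / n)
m<n*[1+m/n] m n = ≤-trans (m<[m/n]*n+n m n) (≤-reflexive (trans (+-comm _ n) (trans (cong (n +_) (*-comm (m / n) n)) (sym (*-suc n (m / n))))))

n*[1+m/n]≤m+n : ∀ m n .{{_ : NonZero n}} → n * suc (m / n) ≤ m + n
n*[1+m/n]≤m+n m n = begin
  n * suc (m / n)    ≡⟨ trans (*-suc n (m / n)) (trans (cong (n +_) (*-comm n (m / n))) (+-comm n _)) ⟩
  (m / n) * n + n    ≤⟨ +-monoˡ-≤ n (m/n*n≤m m n) ⟩
  m + n              ∎

≥-induction : ∀ (P : ℕ → Set) b → P b → (∀ {n} → b ≤ n → P n → P (suc n)) → ∀ {n} → b ≤ n → P n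
≥-induction P b base step b≤n = go (≤⇒≤′ b≤n)
  where
    go : ∀ {n} → b ≤′ n → P n
    go (≤′-reflexive refl) = base
    go (≤′-step b≤′n)      = step (≤′⇒≤ b≤′n) (go b≤′n)

n<2^n : ∀ n → n < 2 ^ n
n<2^n zero    = s≤s z≤n
n<2^n (suc n) = begin-strict
  suc n          <⟨ s≤s (n<2^n n) ⟩
  suc (2 ^ n)    ≤⟨ +-monoˡ-≤ (2 ^ n) (m^n>0 2 n) ⟩
  2 ^ n + 2 ^ n  ≡⟨ cong (2 ^ n +_) (sym (+-identityʳ (2 ^ n))) ⟩
  2 ^ suc n      ∎

4*[t+3]≤3*2^t : ∀ {t} → 3 ≤ t → 4 * (t + 3) ≤ 3 * 2 ^ t
4*[t+3]≤3*2^t = ≥-induction (λ t → 4 * (t + 3) ≤ 3 * 2 ^ t) 3 (≤ᵇ⇒≤ 24 24 tt) step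
  where
    step : ∀ {n} → 3 ≤ n → 4 * (n + 3) ≤ 3 * 2 ^ n → 4 * (suc n + 3) ≤ 3 * 2 ^ suc n
    step {n} 3≤n ih = begin
      4 * (suc n + 3)          ≡⟨ unfold n ⟩
      4 * (n + 3) + 4          ≤⟨ +-mono-≤ ih (≤-trans (≤ᵇ⇒≤ 4 24 tt) (*-monoʳ-≤ 3 (^-monoʳ-≤ 2 3≤n))) ⟩
      3 * 2 ^ n + 3 * 2 ^ n    ≡⟨ double (2 ^ n) ⟩
      3 * 2 ^ suc n            ∎
      where
        unfold : ∀ n → 4 * (suc n + 3) ≡ 4 * (n + 3) + 4
        unfold = solve-∀
        double : ∀ X → 3 * X + 3 * X ≡ 3 * (2 * X)
        double = solve-∀

[t+4]²≤2^t : ∀ {t} → 8 ≤ t → (t + 4) * (t + 4) ≤ 2 ^ t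
[t+4]²≤2^t = ≥-induction (λ t → (t + 4) * (t + 4) ≤ 2 ^ t) 8 (≤ᵇ⇒≤ 144 256 tt) step
  where
    step : ∀ {n} → 8 ≤ n → (n + 4) * (n + 4) ≤ 2 ^ n → (suc n + 4) * (suc n + 4) ≤ 2 ^ suc n
    step {n} _ ih = begin
      (suc n + 4) * (suc n + 4)         ≡⟨ unfold n ⟩
      (n + 4) * (n + 4) + (2 * n + 9)   ≤⟨ +-monoʳ-≤ ((n + 4) * (n + 4)) (≤-trans increment≤square ih) ⟩
      (n + 4) * (n + 4) + 2 ^ n         ≤⟨ +-monoˡ-≤ (2 ^ n) ih ⟩
      2 ^ n + 2 ^ n                     ≡⟨ cong (2 ^ n +_) (sym (+-identityʳ (2 ^ n))) ⟩
      2 ^ suc n                         ∎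
      where
        unfold : ∀ n → (suc n + 4) * (suc n + 4) ≡ (n + 4) * (n + 4) + (2 * n + 9)
        unfold = solve-∀
        square : ∀ n → 2 * n + 9 + (n * n + 6 * n + 7) ≡ (n + 4) * (n + 4)
        square = solve-∀
        increment≤square : 2 * n + 9 ≤ (n + 4) * (n + 4)
        increment≤square = ≤-trans (m≤m+n (2 * n + 9) _) (≤-reflexive (square n))

k₀ : ℕ
k₀ = 128

192*k²*7^k≤8^k : ∀ {k} → k₀ ≤ k → 192 * (k * k) * 7 ^ k ≤ 8 ^ k
192*k²*7^k≤8^k = ≥-induction (λ k → 192 * (k * k) * 7 ^ k ≤ 8 ^ k) k₀ (≤ᵇ⇒≤ (192 * (k₀ * k₀) * 7 ^ k₀) (8 ^ k₀) tt) step
  where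
    7*[1+n]²≤8*n² : ∀ {n} → 15 ≤ n → 7 * (suc n * suc n) ≤ 8 * (n * n)
    7*[1+n]²≤8*n² {n} 15≤n = begin
      7 * (suc n * suc n)          ≡⟨ unfold n ⟩
      7 * (n * n) + (14 * n + 7)   ≤⟨ +-monoʳ-≤ (7 * (n * n)) (≤-trans (+-monoʳ-≤ (14 * n) (≤-trans (≤ᵇ⇒≤ 7 15 tt) 15≤n))
                                                                       (≤-trans (≤-reflexive (fifteen n)) (*-monoˡ-≤ n 15≤n))) ⟩
      7 * (n * n) + n * n          ≡⟨ eight n ⟩
      8 * (n * n)                  ∎
      where
        unfold : ∀ n → 7 * (suc n * suc n) ≡ 7 * (n * n) + (14 * n + 7)
        unfold = solve-∀
        fifteen : ∀ n → 14 * n + n ≡ 15 * n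
        fifteen = solve-∀
        eight : ∀ n → 7 * (n * n) + n * n ≡ 8 * (n * n)
        eight = solve-∀
    step : ∀ {n} → k₀ ≤ n → 192 * (n * n) * 7 ^ n ≤ 8 ^ n → 192 * (suc n * suc n) * 7 ^ suc n ≤ 8 ^ suc n
    step {n} k₀≤n ih = begin
      192 * (suc n * suc n) * (7 * 7 ^ n)   ≡⟨ shift (suc n * suc n) (7 ^ n) ⟩
      192 * (7 * (suc n * suc n)) * 7 ^ n   ≤⟨ *-monoˡ-≤ (7 ^ n) (*-monoʳ-≤ 192 (7*[1+n]²≤8*n² (≤-trans (≤ᵇ⇒≤ 15 k₀ tt) k₀≤n))) ⟩
      192 * (8 * (n * n)) * 7 ^ n           ≡⟨ unshift (n * n) (7 ^ n) ⟩
      8 * (192 * (n * n) * 7 ^ n)           ≤⟨ *-monoʳ-≤ 8 ih ⟩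
      8 * 8 ^ n                             ∎
      where
        shift : ∀ Q P → 192 * Q * (7 * P) ≡ 192 * (7 * Q) * P
        shift = solve-∀
        unshift : ∀ Q P → 192 * (8 * Q) * P ≡ 8 * (192 * Q * P)
        unshift = solve-∀

192*k²*b^k≤m^k : ∀ {k b m} → k₀ ≤ k → 8 * b ≤ 7 * m → 192 * (k * k) * b ^ k ≤ m ^ k
192*k²*b^k≤m^k {k} {b} {m} k₀≤k 8b≤7m = *-cancelˡ-≤ (8 ^ k) {{m^n≢0 8 k}} (begin
  8 ^ k * (192 * (k * k) * b ^ k)   ≡⟨ shift (8 ^ k) (k * k) (b ^ k) ⟩
  192 * (k * k) * (8 ^ k * b ^ k)   ≡⟨ cong (192 * (k * k) *_) (sym (^-distribʳ-* 8 b k)) ⟩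
  192 * (k * k) * (8 * b) ^ k       ≤⟨ *-monoʳ-≤ (192 * (k * k)) (^-monoˡ-≤ k 8b≤7m) ⟩
  192 * (k * k) * (7 * m) ^ k       ≡⟨ cong (192 * (k * k) *_) (^-distribʳ-* 7 m k) ⟩
  192 * (k * k) * (7 ^ k * m ^ k)   ≡⟨ sym (*-assoc (192 * (k * k)) (7 ^ k) (m ^ k)) ⟩
  192 * (k * k) * 7 ^ k * m ^ k     ≤⟨ *-monoˡ-≤ (m ^ k) (192*k²*7^k≤8^k k₀≤k) ⟩
  8 ^ k * m ^ k                     ∎)
  where
    shift : ∀ E Q B → E * (192 * Q * B) ≡ 192 * Q * (E * B)
    shift = solve-∀

k⁸*2¹²≤2^k : ∀ {k} → k₀ ≤ k → k ^ 8 * 2 ^ 12 ≤ 2 ^ k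
k⁸*2¹²≤2^k = ≥-induction (λ k → k ^ 8 * 2 ^ 12 ≤ 2 ^ k) k₀ (≤ᵇ⇒≤ (k₀ ^ 8 * 2 ^ 12) (2 ^ k₀) tt) step
  where
    step : ∀ {n} → k₀ ≤ n → n ^ 8 * 2 ^ 12 ≤ 2 ^ n → suc n ^ 8 * 2 ^ 12 ≤ 2 ^ suc n
    step {n} k₀≤n ih = begin
      suc n ^ 8 * 2 ^ 12     ≤⟨ *-monoˡ-≤ (2 ^ 12) [1+n]⁸≤2n⁸ ⟩
      2 * n ^ 8 * 2 ^ 12     ≡⟨ *-assoc 2 (n ^ 8) (2 ^ 12) ⟩
      2 * (n ^ 8 * 2 ^ 12)   ≤⟨ *-monoʳ-≤ 2 ih ⟩
      2 * 2 ^ n              ∎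
      where
        [1+n]⁸≤2n⁸ : suc n ^ 8 ≤ 2 * n ^ 8
        [1+n]⁸≤2n⁸ = subst (λ z → z ^ 8 ≤ 2 * n ^ 8) (+-comm n 1)
                       ([u+d]^j≤2u^j 8 n 1 (≤-trans (≤ᵇ⇒≤ 16 k₀ tt) (≤-trans k₀≤n (m≤m+n n 1))))

opaque
  C : ℕ
  C = 2 ^ k₀

  2^k≤C : ∀ {k} → k ≤ k₀ → 2 ^ k ≤ C
  2^k≤C = ^-monoʳ-≤ 2

2≤C : 2 ≤ C
2≤C = 2^k≤C {1} (s≤s z≤n)

32≤C : 32 ≤ C
32≤C = 2^k≤C {5} (≤ᵇ⇒≤ 5 k₀ tt)

instance
  C≢0 : NonZero C
  C≢0 = >-nonZero (≤-trans (s≤s z≤n) 2≤C)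

-- With m = a + b, K = 2 ^ k and p = a / m, taking binary logarithms and dividing by K m ^ (1 + k)
-- turns this into the paper's inequality  H(p) + (1 - p) ^ k ≤ 1 + C / 2 ^ k.
EntropyBound : ℕ → ℕ → ℕ → Set
EntropyBound k a b =
  ((a + b) ^ (a + b)) ^ (2 ^ k * (a + b) ^ k) * 2 ^ (2 ^ k * (a + b) * b ^ k)
    ≤ (a ^ a * b ^ b) ^ (2 ^ k * (a + b) ^ k) * 2 ^ ((2 ^ k + C) * ((a + b) * (a + b) ^ k))

-- Gibbs' inequality: any positive weights α, β bound the entropy from above.
entropy-via-weights : ∀ a b α β Z X Y .{{_ : NonZero a}} .{{_ : NonZero b}} .{{_ : NonZero α}} .{{_ : NonZero β}} →
  ((α + β) ^ (a + b)) ^ Z * X ≤ (α ^ a * β ^ b) ^ Z * Y →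
  ((a + b) ^ (a + b)) ^ Z * X ≤ (a ^ a * b ^ b) ^ Z * Y
entropy-via-weights a b α β Z X Y weighted = *-cancelʳ-≤ _ _ (P ^ Z) {{P^Z≢0}} (begin
    (m ^ m) ^ Z * X * P ^ Z                    ≡⟨ *-CS.xy∙z≈xz∙y ((m ^ m) ^ Z) X (P ^ Z) ⟩
    (m ^ m) ^ Z * P ^ Z * X                    ≡⟨ cong (_* X) (sym (^-distribʳ-* (m ^ m) P Z)) ⟩
    (m ^ m * P) ^ Z * X                        ≤⟨ *-monoˡ-≤ X (^-monoˡ-≤ Z (gibbs a b α β)) ⟩
    ((α + β) ^ m * (a ^ a * b ^ b)) ^ Z * X    ≡⟨ cong (_* X) (^-distribʳ-* ((α + β) ^ m) (a ^ a * b ^ b) Z) ⟩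
    ((α + β) ^ m) ^ Z * (a ^ a * b ^ b) ^ Z * X
                                               ≡⟨ *-CS.xy∙z≈y∙xz (((α + β) ^ m) ^ Z) ((a ^ a * b ^ b) ^ Z) X ⟩
    (a ^ a * b ^ b) ^ Z * (((α + β) ^ m) ^ Z * X)
                                               ≤⟨ *-monoʳ-≤ ((a ^ a * b ^ b) ^ Z) weighted ⟩
    (a ^ a * b ^ b) ^ Z * (P ^ Z * Y)          ≡⟨ *-CS.x∙yz≈xz∙y ((a ^ a * b ^ b) ^ Z) (P ^ Z) Y ⟩
    (a ^ a * b ^ b) ^ Z * Y * P ^ Z            ∎)
  where
    m = a + b
    P = α ^ a * β ^ b
    P^Z≢0 : NonZero (P ^ Z)
    P^Z≢0 = m^n≢0 P Z {{m*n≢0 (α ^ a) (β ^ b) {{m^n≢0 α a}} {{m^n≢0 β b}}}}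

-- The weights 1, 1 give only H ≤ 1; the hypothesis says (1 - p) ^ k ≤ C / 2 ^ k.
entropyBound-coarse : ∀ k a b .{{_ : NonZero a}} .{{_ : NonZero b}} →
  2 ^ k * b ^ k ≤ C * (a + b) ^ k → EntropyBound k a b
entropyBound-coarse k a b tail≤C = entropy-via-weights a b 1 1 Z (2 ^ (K * m * b ^ k)) (2 ^ F) (begin
    (2 ^ m) ^ Z * 2 ^ (K * m * b ^ k)    ≡⟨ cong (_* 2 ^ (K * m * b ^ k)) (^-*-assoc 2 m Z) ⟩
    2 ^ (m * Z) * 2 ^ (K * m * b ^ k)    ≡⟨ sym (^-distribˡ-+-* 2 (m * Z) (K * m * b ^ k)) ⟩
    2 ^ (m * Z + K * m * b ^ k)          ≤⟨ ^-monoʳ-≤ 2 exponent ⟩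
    2 ^ F                                ≡⟨ sym (*-identityˡ (2 ^ F)) ⟩
    1 * 2 ^ F                            ≡⟨ cong (_* 2 ^ F) (sym (trans (cong (_^ Z) (cong₂ _*_ (^-zeroˡ a) (^-zeroˡ b))) (^-zeroˡ Z))) ⟩
    (1 ^ a * 1 ^ b) ^ Z * 2 ^ F          ∎)
  where
    K = 2 ^ k
    m = a + b
    Z = K * m ^ k
    F = (K + C) * (m * m ^ k)
    exponent : m * Z + K * m * b ^ k ≤ F
    exponent = begin
        m * (K * m ^ k) + K * m * b ^ k    ≡⟨ split m K (m ^ k) (b ^ k) ⟩
        K * (m * m ^ k) + m * (K * b ^ k)  ≤⟨ +-monoʳ-≤ (K * (m * m ^ k)) (*-monoʳ-≤ m tail≤C) ⟩
        K * (m * m ^ k) + m * (C * m ^ k)  ≡⟨ collect m K (m ^ k) C ⟩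
        F                                  ∎
      where
        split : ∀ m K M B → m * (K * M) + K * m * B ≡ K * (m * M) + m * (K * B)
        split = solve-∀
        collect : ∀ m K M C → K * (m * M) + m * (C * M) ≡ (K + C) * (m * M)
        collect = solve-∀

^-split-product : ∀ u v a x Z N L → ((u ^ a * v ^ x) ^ Z) ^ (N * L) ≡ (u ^ L) ^ (a * Z * N) * (v ^ N) ^ (x * Z * L)
^-split-product u v a x Z N L = begin-equality
    ((u ^ a * v ^ x) ^ Z) ^ (N * L)             ≡⟨ ^-*-assoc (u ^ a * v ^ x) Z (N * L) ⟩
    (u ^ a * v ^ x) ^ (Z * (N * L))             ≡⟨ ^-distribʳ-* (u ^ a) (v ^ x) (Z * (N * L)) ⟩
    (u ^ a) ^ (Z * (N * L)) * (v ^ x) ^ (Z * (N * L))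
                                                ≡⟨ cong₂ _*_ (^-^-reassoc u a _ L _ (left a Z N L)) (^-^-reassoc v x _ N _ (right x Z N L)) ⟩
    (u ^ L) ^ (a * Z * N) * (v ^ N) ^ (x * Z * L) ∎
  where
    left : ∀ a Z N L → a * (Z * (N * L)) ≡ L * (a * Z * N)
    left = solve-∀
    right : ∀ x Z N L → x * (Z * (N * L)) ≡ N * (x * Z * L)
    right = solve-∀

-- The hypotheses say log₂ (β / M) ≥ 1 / N and log₂ (W / R) ≤ 1 / L; after raising both sides
-- to the power N L, the exponent condition is what remains.
log-ratio-comparison : ∀ a x Z E N L W M R β .{{_ : NonZero N}} .{{_ : NonZero L}} →
  2 * M ^ N ≤ β ^ N → W ^ L ≤ 2 * R ^ L → a * Z * N + E * (N * L) ≤ x * Z * L →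
  (W ^ a * M ^ x) ^ Z * 2 ^ E ≤ (R ^ a * β ^ x) ^ Z
log-ratio-comparison a x Z E N L W M R β β-large W-small exponents =
  ^-cancelˡ-≤ (N * L) {{m*n≢0 N L}} (*-cancelʳ-≤ _ _ (2 ^ B) {{m^n≢0 2 B}} (begin
    ((W ^ a * M ^ x) ^ Z * 2 ^ E) ^ S * 2 ^ B
      ≡⟨ cong (_* 2 ^ B) (trans (^-distribʳ-* _ (2 ^ E) S)
                                (cong₂ _*_ (^-split-product W M a x Z N L) (^-*-assoc 2 E S))) ⟩
    (W ^ L) ^ A * (M ^ N) ^ B * 2 ^ (E * S) * 2 ^ B
      ≡⟨ regroup ((W ^ L) ^ A) ((M ^ N) ^ B) (2 ^ (E * S)) (2 ^ B) ⟩
    (W ^ L) ^ A * (2 ^ B * (M ^ N) ^ B) * 2 ^ (E * S)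
      ≡⟨ cong (λ z → (W ^ L) ^ A * z * 2 ^ (E * S)) (sym (^-distribʳ-* 2 (M ^ N) B)) ⟩
    (W ^ L) ^ A * (2 * M ^ N) ^ B * 2 ^ (E * S)
      ≤⟨ *-monoˡ-≤ (2 ^ (E * S)) (*-mono-≤ (^-monoˡ-≤ A W-small) (^-monoˡ-≤ B β-large)) ⟩
    (2 * R ^ L) ^ A * (β ^ N) ^ B * 2 ^ (E * S)
      ≡⟨ cong (λ z → z * (β ^ N) ^ B * 2 ^ (E * S)) (^-distribʳ-* 2 (R ^ L) A) ⟩
    2 ^ A * (R ^ L) ^ A * (β ^ N) ^ B * 2 ^ (E * S)
      ≡⟨ regroup′ (2 ^ A) ((R ^ L) ^ A) ((β ^ N) ^ B) (2 ^ (E * S)) ⟩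
    (R ^ L) ^ A * (β ^ N) ^ B * (2 ^ A * 2 ^ (E * S))
      ≡⟨ cong₂ _*_ (sym (^-split-product R β a x Z N L)) (sym (^-distribˡ-+-* 2 A (E * S))) ⟩
    ((R ^ a * β ^ x) ^ Z) ^ S * 2 ^ (A + E * S)
      ≤⟨ *-monoʳ-≤ (((R ^ a * β ^ x) ^ Z) ^ S) (^-monoʳ-≤ 2 exponents) ⟩
    ((R ^ a * β ^ x) ^ Z) ^ S * 2 ^ B ∎))
  where
    S = N * L
    A = a * Z * N
    B = x * Z * L
    regroup : ∀ P Q T U → P * Q * T * U ≡ P * (U * Q) * T
    regroup = solve-∀
    regroup′ : ∀ A P Q T → A * P * Q * T ≡ P * Q * (A * T)
    regroup′ = solve-∀

balanced-polynomial : ∀ a x Mk B K₂ → let m = a + (a + x) in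
  m * m ≤ 16 * K₂ * (x * x) → 192 * K₂ * B ≤ Mk →
  m * B * (4 * a + 3 * x) * (2 * m * m) ≤ (a + x) * (4 * a + x) * (x * x * Mk)
balanced-polynomial a x Mk B K₂ m²≤ B≤ = *-cancelˡ-≤ 2 (begin
    2 * (m * B * (4 * a + 3 * x) * (2 * m * m))   ≡⟨ cube m B (4 * a + 3 * x) ⟩
    4 * (m * m * m) * B * (4 * a + 3 * x)          ≤⟨ *-monoʳ-≤ (4 * (m * m * m) * B) (≤-trans (m≤m+n (4 * a + 3 * x) (2 * a)) (≤-reflexive (triple a x))) ⟩
    4 * (m * m * m) * B * (3 * m)                  ≡⟨ square m B ⟩
    12 * B * (m * m) * (m * m)                     ≤⟨ *-monoˡ-≤ (m * m) (*-monoʳ-≤ (12 * B) m²≤) ⟩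
    12 * B * (16 * K₂ * (x * x)) * (m * m)         ≡⟨ gather B K₂ (x * x) (m * m) ⟩
    192 * K₂ * B * (x * x) * (m * m)               ≤⟨ *-monoˡ-≤ (m * m) (*-monoˡ-≤ (x * x) B≤) ⟩
    Mk * (x * x) * (m * m)                         ≤⟨ *-monoʳ-≤ (Mk * (x * x)) (m≤m+n (m * m) (4 * (a * a) + 6 * (a * x) + x * x)) ⟩
    Mk * (x * x) * (m * m + (4 * (a * a) + 6 * (a * x) + x * x))
                                                   ≡⟨ factor a x Mk ⟩
    2 * ((a + x) * (4 * a + x) * (x * x * Mk))     ∎)
  where
    m = a + (a + x)
    cube : ∀ m B C → 2 * (m * B * C * (2 * m * m)) ≡ 4 * (m * m * m) * B * C
    cube = solve-∀
    triple : ∀ a x → 4 * a + 3 * x + 2 * a ≡ 3 * (a + (a + x))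
    triple = solve-∀
    square : ∀ m B → 4 * (m * m * m) * B * (3 * m) ≡ 12 * B * (m * m) * (m * m)
    square = solve-∀
    gather : ∀ B K X Y → 12 * B * (16 * K * X) * Y ≡ 192 * K * B * X * Y
    gather = solve-∀
    factor : ∀ a x M → M * (x * x) * ((a + (a + x)) * (a + (a + x)) + (4 * (a * a) + 6 * (a * x) + x * x))
                       ≡ 2 * ((a + x) * (4 * a + x) * (x * x * M))
    factor = solve-∀

balanced-exponent : ∀ a x Mk B N L .{{_ : NonZero x}} → let m = a + (a + x) in
  x * N ≤ 2 * m + x → x * x * L ≤ 2 * m * m → 2 * m * m ≤ x * x * L + x * x →
  m * B * (4 * a + 3 * x) * (2 * m * m) ≤ (a + x) * (4 * a + x) * (x * x * Mk) →
  a * Mk * N + m * B * N * L ≤ x * Mk * L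
balanced-exponent a x Mk B N L xN≤ x²L≤ ≤x²L+x² polynomial =
  *-cancelˡ-≤ (x * x * x) {{m*n≢0 (x * x) x {{m*n≢0 x x}}}} (+-cancelʳ-≤ (P * (x * x)) _ _ (begin
    x * x * x * (a * Mk * N + m * B * N * L) + P * (x * x)
      ≡⟨ cong (_+ P * (x * x)) (distribute a x Mk B N L m) ⟩
    a * Mk * (x * x) * (x * N) + m * B * (x * N) * (x * x * L) + P * (x * x)
      ≤⟨ +-monoˡ-≤ (P * (x * x)) (+-mono-≤ (*-monoʳ-≤ (a * Mk * (x * x)) xN≤) (*-mono-≤ (*-monoʳ-≤ (m * B) xN≤) x²L≤)) ⟩
    a * Mk * (x * x) * (2 * m + x) + m * B * (2 * m + x) * (2 * m * m) + P * (x * x)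
      ≡⟨ cong (λ z → a * Mk * (x * x) * z + m * B * z * (2 * m * m) + P * (x * x)) (twice a x) ⟩
    a * Mk * (x * x) * (4 * a + 3 * x) + m * B * (4 * a + 3 * x) * (2 * m * m) + P * (x * x)
      ≤⟨ +-monoˡ-≤ (P * (x * x)) (+-monoʳ-≤ (a * Mk * (x * x) * (4 * a + 3 * x)) polynomial) ⟩
    a * Mk * (x * x) * (4 * a + 3 * x) + (a + x) * (4 * a + x) * (x * x * Mk) + x * x * Mk * (x * x)
      ≡⟨ collect a x Mk ⟩
    x * x * Mk * (2 * m * m)
      ≤⟨ *-monoʳ-≤ (x * x * Mk) ≤x²L+x² ⟩
    x * x * Mk * (x * x * L + x * x)
      ≡⟨ expand x Mk L ⟩
    x * x * x * (x * Mk * L) + P * (x * x) ∎))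
  where
    m = a + (a + x)
    P = x * x * Mk
    distribute : ∀ a x Mk B N L m → x * x * x * (a * Mk * N + m * B * N * L) ≡ a * Mk * (x * x) * (x * N) + m * B * (x * N) * (x * x * L)
    distribute = solve-∀
    twice : ∀ a x → 2 * (a + (a + x)) + x ≡ 4 * a + 3 * x
    twice = solve-∀
    collect : ∀ a x Mk → a * Mk * (x * x) * (4 * a + 3 * x) + (a + x) * (4 * a + x) * (x * x * Mk) + x * x * Mk * (x * x)
                         ≡ x * x * Mk * (2 * (a + (a + x)) * (a + (a + x)))
    collect = solve-∀
    expand : ∀ x Mk L → x * x * Mk * (x * x * L + x * x) ≡ x * x * x * (x * Mk * L) + x * x * Mk * (x * x)
    expand = solve-∀

-- The weights α = 4a + x and β = 4a + 3x satisfy α + β = 2M and αβ = M² - x² for M = 2m; with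
-- N = ⌊M / x⌋ + 1 and L = ⌊M² / 2x²⌋ we get (β / M) ^ N ≥ 2 and (M² / αβ) ^ L ≤ 2.
entropyBound-balanced : ∀ k a x .{{_ : NonZero a}} .{{_ : NonZero x}} →
  (a + (a + x)) * (a + (a + x)) ≤ 16 * (k * k) * (x * x) →
  192 * (k * k) * (a + x) ^ k ≤ (a + (a + x)) ^ k →
  EntropyBound k a (a + x)
entropyBound-balanced k a x m²≤ tail≤ = entropy-via-weights a b α β Z (2 ^ E) (2 ^ F) weighted
  where
    b = a + x
    m = a + b
    K = 2 ^ k
    Z = K * m ^ k
    E = K * m * b ^ k
    F = (K + C) * (m * m ^ k)
    α = 4 * a + x
    β = 4 * a + 3 * x
    M = 2 * m
    W = M * M
    R = α * β
    N = suc (M / x)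
    L = (2 * m * m) / (x * x)
    instance
      b≢0 : NonZero b
      b≢0 = m+n≢0 a x
      α≢0 : NonZero α
      α≢0 = >-nonZero (≤-trans (>-nonZero⁻¹ a) (≤-trans (m≤n*m a 4) (m≤m+n (4 * a) x)))
      β≢0 : NonZero β
      β≢0 = >-nonZero (≤-trans (>-nonZero⁻¹ a) (≤-trans (m≤n*m a 4) (m≤m+n (4 * a) (3 * x))))
      x²≢0 : NonZero (x * x)
      x²≢0 = m*n≢0 x x
      L≢0 : NonZero L
      L≢0 = >-nonZero (m≥n⇒m/n>0 (≤-trans (*-mono-≤ x≤m x≤m) (≤-trans (m≤n+m (m * m) (m * m)) (≤-reflexive (double m)))))
        where
          x≤m : x ≤ m
          x≤m = ≤-trans (m≤n+m x (a + a)) (≤-reflexive (+-assoc a a x))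
          double : ∀ m → m * m + m * m ≡ 2 * m * m
          double = solve-∀
    β≡M+x : β ≡ M + x
    β≡M+x = identity a x
      where
        identity : ∀ a x → 4 * a + 3 * x ≡ 2 * (a + (a + x)) + x
        identity = solve-∀
    W≡R+x² : W ≡ R + x * x
    W≡R+x² = identity a x
      where
        identity : ∀ a x → 2 * (a + (a + x)) * (2 * (a + (a + x))) ≡ (4 * a + x) * (4 * a + 3 * x) + x * x
        identity = solve-∀
    β-large : 2 * M ^ N ≤ β ^ N
    β-large = subst (λ z → 2 * M ^ N ≤ z ^ N) (sym β≡M+x)
                (2M^[1+n]≤[M+x]^[1+n] (M / x) M x (≤-trans (<⇒≤ (m<n*[1+m/n] M x)) (≤-reflexive (*-comm x N))))
    W-small : W ^ L ≤ 2 * R ^ L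
    W-small = subst (λ z → z ^ L ≤ 2 * R ^ L) (sym W≡R+x²) ([u+d]^j≤2u^j L R (x * x) (begin
      2 * L * (x * x)     ≡⟨ *-assoc 2 L (x * x) ⟩
      2 * (L * (x * x))   ≤⟨ *-monoʳ-≤ 2 (m/n*n≤m (2 * m * m) (x * x)) ⟩
      2 * (2 * m * m)     ≡⟨ quadruple m ⟩
      W                   ≡⟨ W≡R+x² ⟩
      R + x * x           ∎))
      where
        quadruple : ∀ m → 2 * (2 * m * m) ≡ 2 * m * (2 * m)
        quadruple = solve-∀
    exponents : a * Z * N + E * (N * L) ≤ x * Z * L
    exponents = begin
        a * Z * N + E * (N * L)                  ≡⟨ factor a K (m ^ k) N m (b ^ k) L ⟩
        K * (a * m ^ k * N + m * b ^ k * N * L)  ≤⟨ *-monoʳ-≤ K (balanced-exponent a x (m ^ k) (b ^ k) N L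
                                                     (n*[1+m/n]≤m+n M x)
                                                     (≤-trans (≤-reflexive (*-comm (x * x) L)) (m/n*n≤m (2 * m * m) (x * x)))
                                                     (≤-trans (<⇒≤ (m<[m/n]*n+n (2 * m * m) (x * x))) (≤-reflexive (cong (_+ x * x) (*-comm L (x * x)))))
                                                     (balanced-polynomial a x (m ^ k) (b ^ k) (k * k) m²≤ tail≤)) ⟩
        K * (x * m ^ k * L)                      ≡⟨ unfactor x K (m ^ k) L ⟩
        x * Z * L                                ∎
      where
        factor : ∀ a K M N m B L → a * (K * M) * N + K * m * B * (N * L) ≡ K * (a * M * N + m * B * N * L)
        factor = solve-∀
        unfactor : ∀ x K M L → K * (x * M * L) ≡ x * (K * M) * L
        unfactor = solve-∀
    weighted : ((α + β) ^ m) ^ Z * 2 ^ E ≤ (α ^ a * β ^ b) ^ Z * 2 ^ F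
    weighted = begin
        ((α + β) ^ m) ^ Z * 2 ^ E                  ≡⟨ cong (λ z → (z ^ m) ^ Z * 2 ^ E) (α+β≡2M a x) ⟩
        ((2 * M) ^ m) ^ Z * 2 ^ E                  ≡⟨ cong (λ z → z ^ Z * 2 ^ E) (^-distribʳ-* 2 M m) ⟩
        (2 ^ m * M ^ m) ^ Z * 2 ^ E                ≡⟨ cong (_* 2 ^ E) (^-distribʳ-* (2 ^ m) (M ^ m) Z) ⟩
        (2 ^ m) ^ Z * (M ^ m) ^ Z * 2 ^ E          ≡⟨ *-assoc ((2 ^ m) ^ Z) _ _ ⟩
        (2 ^ m) ^ Z * ((M ^ m) ^ Z * 2 ^ E)        ≡⟨ cong (λ z → (2 ^ m) ^ Z * (z ^ Z * 2 ^ E)) M^m≡W^a*M^x ⟩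
        (2 ^ m) ^ Z * ((W ^ a * M ^ x) ^ Z * 2 ^ E)
          ≤⟨ *-monoʳ-≤ ((2 ^ m) ^ Z) (log-ratio-comparison a x Z E N L W M R β β-large W-small exponents) ⟩
        (2 ^ m) ^ Z * (R ^ a * β ^ x) ^ Z          ≡⟨ cong₂ _*_ (^-*-assoc 2 m Z) (cong (_^ Z) (sym α^a*β^b≡R^a*β^x)) ⟩
        2 ^ (m * Z) * (α ^ a * β ^ b) ^ Z          ≤⟨ *-monoˡ-≤ ((α ^ a * β ^ b) ^ Z) (^-monoʳ-≤ 2 mZ≤F) ⟩
        2 ^ F * (α ^ a * β ^ b) ^ Z                ≡⟨ *-comm (2 ^ F) _ ⟩
        (α ^ a * β ^ b) ^ Z * 2 ^ F                ∎
      where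
        α+β≡2M : ∀ a x → 4 * a + x + (4 * a + 3 * x) ≡ 2 * (2 * (a + (a + x)))
        α+β≡2M = solve-∀
        M^m≡W^a*M^x : M ^ m ≡ W ^ a * M ^ x
        M^m≡W^a*M^x = begin-equality
          M ^ (a + (a + x))          ≡⟨ ^-distribˡ-+-* M a (a + x) ⟩
          M ^ a * M ^ (a + x)        ≡⟨ cong (M ^ a *_) (^-distribˡ-+-* M a x) ⟩
          M ^ a * (M ^ a * M ^ x)    ≡⟨ sym (*-assoc (M ^ a) _ _) ⟩
          M ^ a * M ^ a * M ^ x      ≡⟨ cong (_* M ^ x) (sym (^-distribʳ-* M M a)) ⟩
          W ^ a * M ^ x              ∎
        α^a*β^b≡R^a*β^x : α ^ a * β ^ b ≡ R ^ a * β ^ x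
        α^a*β^b≡R^a*β^x = begin-equality
          α ^ a * β ^ (a + x)        ≡⟨ cong (α ^ a *_) (^-distribˡ-+-* β a x) ⟩
          α ^ a * (β ^ a * β ^ x)    ≡⟨ sym (*-assoc (α ^ a) _ _) ⟩
          α ^ a * β ^ a * β ^ x      ≡⟨ cong (_* β ^ x) (sym (^-distribʳ-* α β a)) ⟩
          R ^ a * β ^ x              ∎
        mZ≤F : m * Z ≤ F
        mZ≤F = ≤-trans (≤-reflexive (swap m K (m ^ k))) (*-monoˡ-≤ (m * m ^ k) (m≤m+n K C))
          where
            swap : ∀ m K M → m * (K * M) ≡ K * (m * M)
            swap = solve-∀

sparse-large-k : ∀ {k t} → 3 ≤ t → 4 * (t + 3) ≤ k → (t + 3) * (2 ^ t + k) ≤ k * 2 ^ t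
sparse-large-k {k} {t} 3≤t 4[t+3]≤k = *-cancelˡ-≤ 4 (begin
    4 * ((t + 3) * (J + k))          ≡⟨ expand t J k ⟩
    4 * (t + 3) * J + 4 * (t + 3) * k ≤⟨ +-mono-≤ (*-monoˡ-≤ J 4[t+3]≤k) (*-monoˡ-≤ k (4*[t+3]≤3*2^t 3≤t)) ⟩
    k * J + 3 * J * k                ≡⟨ collect k J ⟩
    4 * (k * J)                      ∎)
  where
    J = 2 ^ t
    expand : ∀ t J k → 4 * ((t + 3) * (J + k)) ≡ 4 * (t + 3) * J + 4 * (t + 3) * k
    expand = solve-∀
    collect : ∀ k J → k * J + 3 * J * k ≡ 4 * (k * J)
    collect = solve-∀

sparse-medium-k : ∀ {k t} → k₀ ≤ k → k ≤ 4 * t + 11 → t + 5 ≤ k → (t + 3) * (2 ^ t + k) ≤ k * 2 ^ t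
sparse-medium-k {k} {t} k₀≤k k≤4t+11 t+5≤k = begin
    (t + 3) * (J + k)      ≡⟨ *-distribˡ-+ (t + 3) J k ⟩
    (t + 3) * J + (t + 3) * k
                           ≤⟨ +-monoʳ-≤ ((t + 3) * J) (*-monoˡ-≤ k (≤-trans (m≤m+n (t + 3) 2) (≤-trans (≤-reflexive (+-assoc t 3 2)) t+5≤k))) ⟩
    (t + 3) * J + k * k    ≤⟨ +-monoʳ-≤ ((t + 3) * J) (≤-trans k²≤J (m≤m+n J J)) ⟩
    (t + 3) * J + (J + J)  ≡⟨ collect t J ⟩
    (t + 5) * J            ≤⟨ *-monoˡ-≤ J t+5≤k ⟩
    k * J                  ∎
  where
    J = 2 ^ t
    collect : ∀ t J → (t + 3) * J + (J + J) ≡ (t + 5) * J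
    collect = solve-∀
    k²≤J : k * k ≤ J
    k²≤J = ^-cancelˡ-≤ 4 (*-cancelʳ-≤ _ _ (2 ^ 12) (begin
        (k * k) ^ 4 * 2 ^ 12     ≡⟨ cong (_* 2 ^ 12) (trans (^-distribʳ-* k k 4) (sym (^-distribˡ-+-* k 4 4))) ⟩
        k ^ 8 * 2 ^ 12           ≤⟨ k⁸*2¹²≤2^k k₀≤k ⟩
        2 ^ k                    ≤⟨ ^-monoʳ-≤ 2 (≤-trans k≤4t+11 (+-monoʳ-≤ (4 * t) (≤ᵇ⇒≤ 11 12 tt))) ⟩
        2 ^ (4 * t + 12)         ≡⟨ ^-distribˡ-+-* 2 (4 * t) 12 ⟩
        2 ^ (4 * t) * 2 ^ 12     ≡⟨ cong (λ e → 2 ^ e * 2 ^ 12) (*-comm 4 t) ⟩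
        2 ^ (t * 4) * 2 ^ 12     ≡⟨ cong (_* 2 ^ 12) (sym (^-*-assoc 2 t 4)) ⟩
        J ^ 4 * 2 ^ 12           ∎))

sparse-small-k : ∀ {k t} → k₀ ≤ k → k ≤ t + 4 →
                 2 ^ k * ((t + 3) * (2 ^ t + k)) ≤ 2 ^ k * (k * 2 ^ t) + C * (2 ^ t * 2 ^ t)
sparse-small-k {k} {t} k₀≤k k≤t+4 = begin
    K * ((t + 3) * (J + k))              ≡⟨ expand K t J k ⟩
    K * (t + 3) * J + K * (t + 3) * k    ≤⟨ +-monoˡ-≤ (K * (t + 3) * k) (*-monoˡ-≤ J (*-monoʳ-≤ K t+3≤k+d)) ⟩
    K * (k + d) * J + K * (t + 3) * k    ≡⟨ regroup K k d J (K * (t + 3) * k) ⟩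
    K * (k * J) + (K * d * J + K * (t + 3) * k)
                                         ≤⟨ +-monoʳ-≤ (K * (k * J)) remainder ⟩
    K * (k * J) + C * (J * J)            ∎
  where
    K = 2 ^ k
    J = 2 ^ t
    d = t + 4 ∸ k
    P = 2 ^ d
    k+d≡t+4 : k + d ≡ t + 4
    k+d≡t+4 = m+[n∸m]≡n k≤t+4
    t+3≤k+d : t + 3 ≤ k + d
    t+3≤k+d = ≤-trans (≤-trans (m≤m+n (t + 3) 1) (≤-reflexive (+-assoc t 3 1))) (≤-reflexive (sym k+d≡t+4))
    KP≡16J : K * P ≡ 16 * J
    KP≡16J = trans (sym (^-distribˡ-+-* 2 k d)) (trans (cong (2 ^_) k+d≡t+4) (trans (^-distribˡ-+-* 2 t 4) (*-comm J 16)))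
    instance
      P≢0 : NonZero P
      P≢0 = m^n≢0 2 d
    expand : ∀ K t J k → K * ((t + 3) * (J + k)) ≡ K * (t + 3) * J + K * (t + 3) * k
    expand = solve-∀
    regroup : ∀ K k d J X → K * (k + d) * J + X ≡ K * (k * J) + (K * d * J + X)
    regroup = solve-∀
    first-half : 2 * (K * d * J) ≤ C * (J * J)
    first-half = *-cancelˡ-≤ P (begin
      P * (2 * (K * d * J))    ≡⟨ shift P K d J ⟩
      2 * (K * P) * d * J      ≡⟨ cong (λ z → 2 * z * d * J) KP≡16J ⟩
      2 * (16 * J) * d * J     ≡⟨ thirty-two J d ⟩
      32 * d * (J * J)         ≤⟨ *-monoˡ-≤ (J * J) (*-mono-≤ 32≤C (<⇒≤ (n<2^n d))) ⟩
      C * P * (J * J)          ≡⟨ unshift C P (J * J) ⟩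
      P * (C * (J * J))        ∎)
      where
        shift : ∀ P K d J → P * (2 * (K * d * J)) ≡ 2 * (K * P) * d * J
        shift = solve-∀
        thirty-two : ∀ J d → 2 * (16 * J) * d * J ≡ 32 * d * (J * J)
        thirty-two = solve-∀
        unshift : ∀ C P X → C * P * X ≡ P * (C * X)
        unshift = solve-∀
    second-half : 2 * (K * (t + 3) * k) ≤ C * (J * J)
    second-half = *-cancelˡ-≤ P (begin
      P * (2 * (K * (t + 3) * k))    ≡⟨ shift P K t k ⟩
      2 * (K * P) * ((t + 3) * k)    ≡⟨ cong (λ z → 2 * z * ((t + 3) * k)) KP≡16J ⟩
      2 * (16 * J) * ((t + 3) * k)   ≡⟨ cong (_* ((t + 3) * k)) (sym (*-assoc 2 16 J)) ⟩
      32 * J * ((t + 3) * k)         ≤⟨ *-monoʳ-≤ (32 * J) (*-mono-≤ t+3≤t+4 k≤t+4) ⟩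
      32 * J * ((t + 4) * (t + 4))   ≤⟨ *-monoʳ-≤ (32 * J) ([t+4]²≤2^t 8≤t) ⟩
      32 * J * J                     ≤⟨ *-monoˡ-≤ J (*-monoˡ-≤ J 32≤C) ⟩
      C * J * J                      ≤⟨ m≤m*n (C * J * J) P ⟩
      C * J * J * P                  ≡⟨ unshift C J P ⟩
      P * (C * (J * J))              ∎)
      where
        t+3≤t+4 = +-monoʳ-≤ t (n≤1+n 3)
        8≤t : 8 ≤ t
        8≤t = +-cancelʳ-≤ 4 8 t (≤-trans (≤ᵇ⇒≤ 12 k₀ tt) (≤-trans k₀≤k k≤t+4))
        shift : ∀ P K t k → P * (2 * (K * (t + 3) * k)) ≡ 2 * (K * P) * ((t + 3) * k)
        shift = solve-∀
        unshift : ∀ C J P → C * J * J * P ≡ P * (C * (J * J))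
        unshift = solve-∀
    remainder : K * d * J + K * (t + 3) * k ≤ C * (J * J)
    remainder = *-cancelˡ-≤ 2 (begin
      2 * (K * d * J + K * (t + 3) * k)          ≡⟨ *-distribˡ-+ 2 (K * d * J) _ ⟩
      2 * (K * d * J) + 2 * (K * (t + 3) * k)    ≤⟨ +-mono-≤ first-half second-half ⟩
      C * (J * J) + C * (J * J)                  ≡⟨ cong (C * (J * J) +_) (sym (+-identityʳ _)) ⟩
      2 * (C * (J * J))                          ∎)

sparse-numeric : ∀ {k t} → 3 ≤ t → k₀ ≤ k →
                 2 ^ k * ((t + 3) * (2 ^ t + k)) ≤ 2 ^ k * (k * 2 ^ t) + C * (2 ^ t * 2 ^ t)
sparse-numeric {k} {t} 3≤t k₀≤k with 4 * (t + 3) ≤? k | k ≤? t + 4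
... | yes large | _ = ≤-trans (*-monoʳ-≤ (2 ^ k) (sparse-large-k 3≤t large)) (m≤m+n _ _)
... | no _      | yes small = sparse-small-k k₀≤k small
... | no ¬large | no ¬small = ≤-trans (*-monoʳ-≤ (2 ^ k) (sparse-medium-k {t = t} k₀≤k k≤4t+11 t+5≤k)) (m≤m+n _ _)
  where
    t+5≤k : t + 5 ≤ k
    t+5≤k = ≤-trans (≤-reflexive (+-suc t 4)) (≰⇒> ¬small)
    k≤4t+11 : k ≤ 4 * t + 11
    k≤4t+11 = ≤-pred (≤-trans (≰⇒> ¬large) (≤-reflexive (four t)))
      where
        four : ∀ t → 4 * (t + 3) ≡ suc (4 * t + 11)
        four = solve-∀

bernoulli-tail : ∀ k a b .{{_ : NonZero (a + b)}} → b ^ suc k * ((a + b) + suc k * a) ≤ (a + b) ^ suc k * (a + b)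
bernoulli-tail k a b = *-cancelˡ-≤ (m ^ k) {{m^n≢0 m k}} (begin
    m ^ k * (b ^ suc k * (m + suc k * a))         ≡⟨ expand (m ^ k) (b ^ suc k) m (suc k) a ⟩
    b ^ suc k * (m ^ suc k + suc k * a * m ^ k)   ≤⟨ *-monoʳ-≤ (b ^ suc k) (bernoulli k m a) ⟩
    b ^ suc k * (m + a) ^ suc k                   ≡⟨ trans (*-comm (b ^ suc k) _) (sym (^-distribʳ-* (m + a) b (suc k))) ⟩
    ((m + a) * b) ^ suc k                         ≤⟨ ^-monoˡ-≤ (suc k) (m≤m+n ((m + a) * b) (a * a)) ⟩
    ((m + a) * b + a * a) ^ suc k                 ≡⟨ cong (_^ suc k) (square a b) ⟩
    (m * m) ^ suc k                               ≡⟨ ^-distribʳ-* m m (suc k) ⟩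
    m ^ suc k * m ^ suc k                         ≡⟨ regroup m (m ^ k) ⟩
    m ^ k * (m ^ suc k * m)                       ∎)
  where
    m = a + b
    expand : ∀ P B m k a → P * (B * (m + k * a)) ≡ B * (m * P + k * a * P)
    expand = solve-∀
    square : ∀ a b → (a + b + a) * b + a * a ≡ (a + b) * (a + b)
    square = solve-∀
    regroup : ∀ m P → m * P * (m * P) ≡ P * (m * P * m)
    regroup = solve-∀

sparse-exponent-core : ∀ k t a b → let m = a + b ; J = 2 ^ t ; K = 2 ^ k in
  3 ≤ t → k₀ ≤ k → J * a ≤ m → m ≤ 2 * J * a →
  K * ((t + 1) * a * J + b) * (m + k * a) ≤ K * m * J * k * a + C * m * J * (m + k * a)
sparse-exponent-core k t a b 3≤t k₀≤k Ja≤m m≤2Ja = begin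
    K * (s * a * J + b) * (m + k * a)
      ≤⟨ *-monoˡ-≤ (m + k * a) (*-monoʳ-≤ K (+-monoʳ-≤ (s * a * J) (≤-trans (m≤n+m b a) m≤2Ja))) ⟩
    K * (s * a * J + 2 * J * a) * (m + k * a)
      ≡⟨ expand K s a J m k ⟩
    K * (s + 2) * (J * a) * m + K * (s + 2) * k * a * (J * a)
      ≤⟨ +-monoʳ-≤ (K * (s + 2) * (J * a) * m) (*-monoʳ-≤ (K * (s + 2) * k * a) Ja≤m) ⟩
    K * (s + 2) * (J * a) * m + K * (s + 2) * k * a * m
      ≡⟨ factor K t J a m k ⟩
    (a * m) * (K * ((t + 3) * (J + k)))
      ≤⟨ *-monoʳ-≤ (a * m) (sparse-numeric 3≤t k₀≤k) ⟩
    (a * m) * (K * (k * J) + C * (J * J))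
      ≡⟨ unfactor a m K k J C ⟩
    K * m * J * k * a + C * m * J * (J * a)
      ≤⟨ +-monoʳ-≤ (K * m * J * k * a) (*-monoʳ-≤ (C * m * J) (≤-trans Ja≤m (m≤m+n m (k * a)))) ⟩
    K * m * J * k * a + C * m * J * (m + k * a) ∎
  where
    m = a + b
    J = 2 ^ t
    K = 2 ^ k
    s = t + 1
    expand : ∀ K s a J m k → K * (s * a * J + 2 * J * a) * (m + k * a) ≡ K * (s + 2) * (J * a) * m + K * (s + 2) * k * a * (J * a)
    expand = solve-∀
    factor : ∀ K t J a m k → K * (t + 1 + 2) * (J * a) * m + K * (t + 1 + 2) * k * a * m ≡ (a * m) * (K * ((t + 3) * (J + k)))
    factor = solve-∀
    unfactor : ∀ a m K k J c → (a * m) * (K * (k * J) + c * (J * J)) ≡ K * m * J * k * a + c * m * J * (J * a)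
    unfactor = solve-∀

sparse-exponent : ∀ k t a b → let m = a + b ; J = 2 ^ t ; K = 2 ^ k in .{{_ : NonZero m}} →
  3 ≤ t → k₀ ≤ k → J * a ≤ m → m ≤ 2 * J * a →
  (t + 1) * a * (K * m ^ k) * J + K * m * b ^ k * J + b * (K * m ^ k) ≤ (K + C) * (m * m ^ k) * J
sparse-exponent k@(suc k′) t a b 3≤t k₀≤k Ja≤m m≤2Ja = *-cancelʳ-≤ _ _ (m + k * a) {{m+ka≢0}} (begin
    (s * a * (K * Mk) * J + K * m * B * J + b * (K * Mk)) * (m + k * a)
      ≡⟨ expand s a K Mk J m B b k ⟩
    Mk * (K * (s * a * J + b) * (m + k * a)) + K * m * J * (B * (m + k * a))
      ≤⟨ +-mono-≤ (*-monoʳ-≤ Mk (sparse-exponent-core k t a b 3≤t k₀≤k Ja≤m m≤2Ja))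
                  (*-monoʳ-≤ (K * m * J) (bernoulli-tail k′ a b)) ⟩
    Mk * (K * m * J * k * a + C * m * J * (m + k * a)) + K * m * J * (Mk * m)
      ≡⟨ collect s a K Mk J m B b k C ⟩
    (K + C) * (m * Mk) * J * (m + k * a) ∎)
  where
    m = a + b
    J = 2 ^ t
    K = 2 ^ k
    s = t + 1
    Mk = m ^ k
    B = b ^ k
    m+ka≢0 : NonZero (m + k * a)
    m+ka≢0 = m+n≢0 m (k * a)
    expand : ∀ s a K Mk J m B b k → (s * a * (K * Mk) * J + K * m * B * J + b * (K * Mk)) * (m + k * a)
                                    ≡ Mk * (K * (s * a * J + b) * (m + k * a)) + K * m * J * (B * (m + k * a))
    expand = solve-∀
    collect : ∀ s a K Mk J m B b k c → Mk * (K * m * J * k * a + c * m * J * (m + k * a)) + K * m * J * (Mk * m)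
                                       ≡ (K + c) * (m * Mk) * J * (m + k * a)
    collect = solve-∀

-- Here 2 ^ -(t + 1) ≤ p ≤ 2 ^ -t, and the weights are 1 and 2 ^ (t + 1) - 1.
entropyBound-sparse : ∀ k t a b .{{_ : NonZero a}} .{{_ : NonZero b}} → 3 ≤ t → k₀ ≤ k →
  2 ^ t * a ≤ a + b → a + b ≤ 2 * 2 ^ t * a → EntropyBound k a b
entropyBound-sparse k t a b 3≤t k₀≤k Ja≤m m≤2Ja =
  entropy-via-weights a b 1 β Z (2 ^ E) (2 ^ F) weighted
  where
    m = a + b
    K = 2 ^ k
    Z = K * m ^ k
    E = K * m * b ^ k
    F = (K + C) * (m * m ^ k)
    J = 2 ^ t
    N = 2 * J
    β = pred N
    instance
      J≢0 : NonZero J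
      J≢0 = m^n≢0 2 t
      m≢0 : NonZero m
      m≢0 = m+n≢0 a b
    1+β≡N : 1 + β ≡ N
    1+β≡N = suc-pred N {{m*n≢0 2 J}}
    instance
      β≢0 : NonZero β
      β≢0 = >-nonZero (≤-pred (subst (2 ≤_) (sym 1+β≡N) (*-monoʳ-≤ 2 (m^n>0 2 t))))
    N^J≤2β^J : N ^ J ≤ 2 * β ^ J
    N^J≤2β^J = subst (λ z → z ^ J ≤ 2 * β ^ J) (trans (+-comm β 1) 1+β≡N)
                 ([u+d]^j≤2u^j J β 1 (≤-reflexive (trans (*-identityʳ (2 * J)) (trans (sym 1+β≡N) (+-comm 1 β)))))
    X^J≡ : ((N ^ m) ^ Z * 2 ^ E) ^ J ≡ 2 ^ ((t + 1) * a * Z * J) * (N ^ J) ^ (b * Z) * 2 ^ (E * J)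
    X^J≡ = begin-equality
        ((N ^ m) ^ Z * 2 ^ E) ^ J                               ≡⟨ ^-distribʳ-* ((N ^ m) ^ Z) (2 ^ E) J ⟩
        ((N ^ m) ^ Z) ^ J * (2 ^ E) ^ J                         ≡⟨ cong₂ _*_ (trans (^-*-assoc (N ^ m) Z J) (^-*-assoc N m (Z * J)))
                                                                             (^-*-assoc 2 E J) ⟩
        N ^ ((a + b) * (Z * J)) * 2 ^ (E * J)                   ≡⟨ cong (λ e → N ^ e * 2 ^ (E * J)) (*-distribʳ-+ (Z * J) a b) ⟩
        N ^ (a * (Z * J) + b * (Z * J)) * 2 ^ (E * J)           ≡⟨ cong (_* 2 ^ (E * J)) (^-distribˡ-+-* N (a * (Z * J)) (b * (Z * J))) ⟩
        N ^ (a * (Z * J)) * N ^ (b * (Z * J)) * 2 ^ (E * J)     ≡⟨ cong (λ z → z * 2 ^ (E * J)) (cong₂ _*_ N-part β-part) ⟩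
        2 ^ ((t + 1) * a * Z * J) * (N ^ J) ^ (b * Z) * 2 ^ (E * J) ∎
      where
        N-part : N ^ (a * (Z * J)) ≡ 2 ^ ((t + 1) * a * Z * J)
        N-part = trans (cong (_^ (a * (Z * J))) (cong (2 ^_) (+-comm 1 t)))
                       (trans (^-*-assoc 2 (t + 1) _) (cong (2 ^_) (reassoc t a Z J)))
          where
            reassoc : ∀ t a Z J → (t + 1) * (a * (Z * J)) ≡ (t + 1) * a * Z * J
            reassoc = solve-∀
        β-part : N ^ (b * (Z * J)) ≡ (N ^ J) ^ (b * Z)
        β-part = trans (cong (N ^_) (reassoc b Z J)) (sym (^-*-assoc N J (b * Z)))
          where
            reassoc : ∀ b Z J → b * (Z * J) ≡ J * (b * Z)
            reassoc = solve-∀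
    Y^J≡ : ((β ^ b) ^ Z * 2 ^ F) ^ J ≡ (β ^ J) ^ (b * Z) * 2 ^ (F * J)
    Y^J≡ = trans (^-distribʳ-* ((β ^ b) ^ Z) (2 ^ F) J)
                 (cong₂ _*_ (trans (^-*-assoc (β ^ b) Z J) (^-^-reassoc β b (Z * J) J (b * Z) (reassoc b Z J)))
                            (^-*-assoc 2 F J))
      where
        reassoc : ∀ b Z J → b * (Z * J) ≡ J * (b * Z)
        reassoc = solve-∀
    weighted : ((1 + β) ^ m) ^ Z * 2 ^ E ≤ (1 ^ a * β ^ b) ^ Z * 2 ^ F
    weighted = subst₂ (λ u v → (u ^ m) ^ Z * 2 ^ E ≤ v ^ Z * 2 ^ F) (sym 1+β≡N)
                 (sym (trans (cong (_* β ^ b) (^-zeroˡ a)) (*-identityˡ _))) (^-cancelˡ-≤ J (begin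
        ((N ^ m) ^ Z * 2 ^ E) ^ J
          ≡⟨ X^J≡ ⟩
        2 ^ A₁ * (N ^ J) ^ (b * Z) * 2 ^ (E * J)
          ≤⟨ *-monoˡ-≤ (2 ^ (E * J)) (*-monoʳ-≤ (2 ^ A₁) (^-monoˡ-≤ (b * Z) N^J≤2β^J)) ⟩
        2 ^ A₁ * (2 * β ^ J) ^ (b * Z) * 2 ^ (E * J)
          ≡⟨ cong (λ z → 2 ^ A₁ * z * 2 ^ (E * J)) (^-distribʳ-* 2 (β ^ J) (b * Z)) ⟩
        2 ^ A₁ * (2 ^ (b * Z) * (β ^ J) ^ (b * Z)) * 2 ^ (E * J)
          ≡⟨ regroup (2 ^ A₁) (2 ^ (b * Z)) ((β ^ J) ^ (b * Z)) (2 ^ (E * J)) ⟩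
        (β ^ J) ^ (b * Z) * (2 ^ A₁ * 2 ^ (E * J) * 2 ^ (b * Z))
          ≡⟨ cong ((β ^ J) ^ (b * Z) *_) (trans (cong (_* 2 ^ (b * Z)) (sym (^-distribˡ-+-* 2 A₁ (E * J))))
                                                 (sym (^-distribˡ-+-* 2 (A₁ + E * J) (b * Z)))) ⟩
        (β ^ J) ^ (b * Z) * 2 ^ (A₁ + E * J + b * Z)
          ≤⟨ *-monoʳ-≤ ((β ^ J) ^ (b * Z)) (^-monoʳ-≤ 2 (sparse-exponent k t a b 3≤t k₀≤k Ja≤m m≤2Ja)) ⟩
        (β ^ J) ^ (b * Z) * 2 ^ (F * J)
          ≡⟨ sym Y^J≡ ⟩
        ((β ^ b) ^ Z * 2 ^ F) ^ J ∎))
      where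
        A₁ = (t + 1) * a * Z * J
        regroup : ∀ A B P T → A * (B * P) * T ≡ P * (A * T * B)
        regroup = solve-∀

dyadic-interval : ∀ f a m .{{_ : NonZero a}} → a ≤ m → m < 2 ^ f * a → Σ ℕ (λ t → 2 ^ t * a ≤ m × m < 2 * 2 ^ t * a)
dyadic-interval zero    a m a≤m m<a = ⊥-elim (<⇒≱ m<a (≤-trans (≤-reflexive (*-identityˡ a)) a≤m))
dyadic-interval (suc f) a m a≤m m<2^[1+f]a with 2 ^ f * a ≤? m
... | yes 2^fa≤m = f , 2^fa≤m , m<2^[1+f]a
... | no  2^fa≰m = dyadic-interval f a m a≤m (≰⇒> 2^fa≰m)

entropyBound-skewed : ∀ k a x .{{_ : NonZero a}} .{{_ : NonZero x}} → k₀ ≤ k → EntropyBound k a (a + x)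
entropyBound-skewed k a x {{a≢0}} k₀≤k with 4 * k * x ≤? m | m ≤? 8 * a
  where m = a + (a + x)
... | yes 4kx≤m | _ = entropyBound-coarse k a (a + x) {{a≢0}} {{m+n≢0 a x}} (begin
    2 ^ k * (a + x) ^ k      ≡⟨ sym (^-distribʳ-* 2 (a + x) k) ⟩
    (2 * (a + x)) ^ k        ≡⟨ cong (_^ k) (twice a x) ⟩
    (a + (a + x) + x) ^ k    ≤⟨ [u+d]^j≤2u^j k (a + (a + x)) x (≤-trans (*-monoˡ-≤ x (*-monoˡ-≤ k (≤ᵇ⇒≤ 2 4 tt))) (≤-trans 4kx≤m (m≤m+n _ x))) ⟩
    2 * (a + (a + x)) ^ k    ≤⟨ *-monoˡ-≤ _ 2≤C ⟩
    C * (a + (a + x)) ^ k    ∎)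
  where
    twice : ∀ a x → 2 * (a + x) ≡ a + (a + x) + x
    twice = solve-∀
... | no 4kx≰m | yes m≤8a = entropyBound-balanced k a x m²≤16k²x² (192*k²*b^k≤m^k k₀≤k 8b≤7m)
  where
    m = a + (a + x)
    m²≤16k²x² : m * m ≤ 16 * (k * k) * (x * x)
    m²≤16k²x² = ≤-trans (*-mono-≤ (<⇒≤ (≰⇒> 4kx≰m)) (<⇒≤ (≰⇒> 4kx≰m))) (≤-reflexive (square k x))
      where
        square : ∀ k x → 4 * k * x * (4 * k * x) ≡ 16 * (k * k) * (x * x)
        square = solve-∀
    8b≤7m : 8 * (a + x) ≤ 7 * m
    8b≤7m = ≤-trans (≤-reflexive (split a x)) (≤-trans (+-monoʳ-≤ (8 * a + 7 * x) x≤6a) (≤-reflexive (collect a x)))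
      where
        split : ∀ a x → 8 * (a + x) ≡ 8 * a + 7 * x + x
        split = solve-∀
        collect : ∀ a x → 8 * a + 7 * x + 6 * a ≡ 7 * (a + (a + x))
        collect = solve-∀
        x≤6a : x ≤ 6 * a
        x≤6a = +-cancelˡ-≤ (2 * a) x (6 * a) (≤-trans (≤-reflexive (lhs a x)) (≤-trans m≤8a (≤-reflexive (rhs a))))
          where
            lhs : ∀ a x → 2 * a + x ≡ a + (a + x)
            lhs = solve-∀
            rhs : ∀ a → 8 * a ≡ 2 * a + 6 * a
            rhs = solve-∀
... | no _ | no m≰8a with dyadic-interval m a m (m≤m+n a _) (<-≤-trans (n<2^n m) (m≤m*n (2 ^ m) a))
  where m = a + (a + x)
...   | t , 2^ta≤m , m<2^[1+t]a = entropyBound-sparse k t a (a + x) {{a≢0}} {{m+n≢0 a x}} 3≤t k₀≤k 2^ta≤m (<⇒≤ m<2^[1+t]a)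
  where
    3≤t : 3 ≤ t
    3≤t with 3 ≤? t
    ... | yes 3≤t = 3≤t
    ... | no 3≰t  = ⊥-elim (<⇒≱ (≰⇒> m≰8a) (≤-trans (<⇒≤ m<2^[1+t]a) (*-monoˡ-≤ a (*-monoʳ-≤ 2 (^-monoʳ-≤ 2 (≤-pred (≰⇒> 3≰t)))))))

entropyBound : ∀ k a b .{{_ : NonZero a}} .{{_ : NonZero b}} → EntropyBound k a b
entropyBound k a b {{a≢0}} with k ≤? k₀ | 2 * b ≤? a + b
... | yes k≤k₀ | _ = entropyBound-coarse k a b (*-mono-≤ (2^k≤C k≤k₀) (^-monoˡ-≤ k (m≤n+m b a)))
... | no _ | yes 2b≤m = entropyBound-coarse k a b
  (≤-trans (≤-reflexive (sym (^-distribʳ-* 2 b k))) (≤-trans (^-monoˡ-≤ k 2b≤m) (m≤n*m _ C)))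
... | no k≰k₀ | no 2b≰m = subst (EntropyBound k a) a+x≡b (entropyBound-skewed k a x {{a≢0}} {{x≢0}} (<⇒≤ (≰⇒> k≰k₀)))
  where
    a<b : a < b
    a<b = +-cancelˡ-< b a b (≤-trans (≤-reflexive (cong suc (+-comm b a)))
                                     (≤-trans (≰⇒> 2b≰m) (≤-reflexive (cong (b +_) (+-identityʳ b)))))
    x = b ∸ a
    a+x≡b : a + x ≡ b
    a+x≡b = m+[n∸m]≡n (<⇒≤ a<b)
    x≢0 : NonZero x
    x≢0 = >-nonZero (m<n⇒0<n∸m a<b)

indicator : Bool → ℕ
indicator true  = 1
indicator false = 0

∑ : {A : Set} → (A → ℕ) → List A → ℕ
∑ f xs = sum (map f xs)

∑-+ : {A : Set} (f g : A → ℕ) (xs : List A) → ∑ (λ x → f x + g x) xs ≡ ∑ f xs + ∑ g xs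
∑-+ f g []       = refl
∑-+ f g (x ∷ xs) = trans (cong (f x + g x +_) (∑-+ f g xs)) (+-CS.interchange (f x) (g x) (∑ f xs) (∑ g xs))

∑-cong : {A : Set} {f g : A → ℕ} (xs : List A) → (∀ x → f x ≡ g x) → ∑ f xs ≡ ∑ g xs
∑-cong []       f≗g = refl
∑-cong (x ∷ xs) f≗g = cong₂ _+_ (f≗g x) (∑-cong xs f≗g)

∑-*ˡ : {A : Set} (c : ℕ) (f : A → ℕ) (xs : List A) → ∑ (λ x → c * f x) xs ≡ c * ∑ f xs
∑-*ˡ c f []       = sym (*-zeroʳ c)
∑-*ˡ c f (x ∷ xs) = trans (cong (c * f x +_) (∑-*ˡ c f xs)) (sym (*-distribˡ-+ c (f x) (∑ f xs)))

∑-++ : {A : Set} (f : A → ℕ) (xs ys : List A) → ∑ f (xs ++ ys) ≡ ∑ f xs + ∑ f ys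
∑-++ f []       ys = refl
∑-++ f (x ∷ xs) ys = trans (cong (f x +_) (∑-++ f xs ys)) (sym (+-assoc (f x) _ _))

∑-map : {A B : Set} (f : B → ℕ) (g : A → B) (xs : List A) → ∑ f (map g xs) ≡ ∑ (f ∘ g) xs
∑-map f g []       = refl
∑-map f g (x ∷ xs) = cong (f (g x) +_) (∑-map f g xs)

∑-concatMap : {A B : Set} (f : B → ℕ) (g : A → List B) (xs : List A) → ∑ f (concatMap g xs) ≡ ∑ (∑ f ∘ g) xs
∑-concatMap f g []       = refl
∑-concatMap f g (x ∷ xs) = trans (∑-++ f (g x) (concatMap g xs)) (cong (∑ f (g x) +_) (∑-concatMap f g xs))

∑-1 : {A : Set} (xs : List A) → ∑ (λ _ → 1) xs ≡ length xs
∑-1 []       = refl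
∑-1 (x ∷ xs) = cong suc (∑-1 xs)

count : {A : Set} → (A → Bool) → List A → ℕ
count p = ∑ (indicator ∘ p)

indicator-∧ : ∀ a b → indicator (a ∧ b) ≡ indicator a * indicator b
indicator-∧ true  b = sym (+-identityʳ (indicator b))
indicator-∧ false b = refl

∑-tuples-all : {A : Set} (p : A → Bool) (xs : List A) (k : ℕ) → ∑ (indicator ∘ all p) (tuples xs k) ≡ count p xs ^ k
∑-tuples-all p xs zero    = refl
∑-tuples-all p xs (suc k) = begin-equality
    ∑ (indicator ∘ all p) (concatMap (λ x → map (x ∷_) (tuples xs k)) xs)
  ≡⟨ ∑-concatMap _ _ xs ⟩
    ∑ (λ x → ∑ (indicator ∘ all p) (map (x ∷_) (tuples xs k))) xs
  ≡⟨ ∑-cong xs (λ x → trans (∑-map _ (x ∷_) (tuples xs k))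
                            (trans (∑-cong (tuples xs k) (λ t → indicator-∧ (p x) (all p t)))
                                   (∑-*ˡ (indicator (p x)) _ (tuples xs k)))) ⟩
    ∑ (λ x → indicator (p x) * ∑ (indicator ∘ all p) (tuples xs k)) xs
  ≡⟨ ∑-cong xs (λ x → trans (cong (indicator (p x) *_) (∑-tuples-all p xs k)) (*-comm (indicator (p x)) _)) ⟩
    ∑ (λ x → count p xs ^ k * indicator (p x)) xs
  ≡⟨ ∑-*ˡ (count p xs ^ k) _ xs ⟩
    count p xs ^ k * count p xs
  ≡⟨ *-comm (count p xs ^ k) _ ⟩
    count p xs ^ suc k
  ∎

length-tuples : {A : Set} (xs : List A) (k : ℕ) → length (tuples xs k) ≡ length xs ^ k
length-tuples {A} xs k = begin-equality
  length (tuples xs k)                          ≡⟨ sym (∑-1 (tuples xs k)) ⟩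
  ∑ (λ _ → 1) (tuples xs k)                     ≡⟨ ∑-cong (tuples xs k) (λ t → cong indicator (sym (all-true t))) ⟩
  ∑ (indicator ∘ all (λ _ → true)) (tuples xs k) ≡⟨ ∑-tuples-all (λ _ → true) xs k ⟩
  count (λ _ → true) xs ^ k                     ≡⟨ cong (_^ k) (∑-1 xs) ⟩
  length xs ^ k                                 ∎
  where
    all-true : (t : List A) → all (λ _ → true) t ≡ true
    all-true []      = refl
    all-true (_ ∷ t) = all-true t

map-tuples : {A B : Set} (g : A → B) (xs : List A) (k : ℕ) → map (map g) (tuples xs k) ≡ tuples (map g xs) k
map-tuples g xs zero    = refl
map-tuples g xs (suc k) = trans (prepend-all (tuples xs k) xs) (cong (λ T → concatMap (λ y → map (y ∷_) T) (map g xs)) (map-tuples g xs k))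
  where
    prepend : ∀ y T → map (map g) (map (y ∷_) T) ≡ map (g y ∷_) (map (map g) T)
    prepend y []      = refl
    prepend y (t ∷ T) = cong ((g y ∷ map g t) ∷_) (prepend y T)
    prepend-all : ∀ T ys → map (map g) (concatMap (λ x → map (x ∷_) T) ys) ≡ concatMap (λ y → map (y ∷_) (map (map g) T)) (map g ys)
    prepend-all T []       = refl
    prepend-all T (y ∷ ys) = trans (map-++ (map g) (map (y ∷_) T) _) (cong₂ _++_ (prepend y T) (prepend-all T ys))

unionAll-∷ : ∀ {n} (t : List (Subset (suc n))) → unionAll t ≡ any head t ∷ unionAll (map tail t)
unionAll-∷ []             = refl
unionAll-∷ ((b ∷ w) ∷ t) = cong (zipWith _∨_ (b ∷ w)) (unionAll-∷ t)

∣∷∣ : ∀ {n} b (p : Subset n) → ∣ b ∷ p ∣ ≡ indicator b + ∣ p ∣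
∣∷∣ true  p = refl
∣∷∣ false p = refl

all-not-head : ∀ {n} (t : List (Subset (suc n))) → all (not ∘ head) t ≡ not (any head t)
all-not-head []                = refl
all-not-head ((true ∷ w) ∷ t)  = refl
all-not-head ((false ∷ w) ∷ t) = all-not-head t

indicator-not : ∀ b → indicator b + indicator (not b) ≡ 1
indicator-not true  = refl
indicator-not false = refl

-- Every tuple either covers the first coordinate or misses it with all of its members.
∣unionAll∣-head : ∀ {n} (t : List (Subset (suc n))) →
  ∣ unionAll t ∣ + indicator (all (not ∘ head) t) ≡ 1 + ∣ unionAll (map tail t) ∣
∣unionAll∣-head t = begin-equality
    ∣ unionAll t ∣ + indicator (all (not ∘ head) t)
  ≡⟨ cong₂ _+_ (trans (cong ∣_∣ (unionAll-∷ t)) (∣∷∣ (any head t) rest)) (cong indicator (all-not-head t)) ⟩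
    indicator (any head t) + ∣ rest ∣ + indicator (not (any head t))
  ≡⟨ +-CS.xy∙z≈xz∙y (indicator (any head t)) ∣ rest ∣ _ ⟩
    indicator (any head t) + indicator (not (any head t)) + ∣ rest ∣
  ≡⟨ cong (_+ ∣ rest ∣) (indicator-not (any head t)) ⟩
    1 + ∣ rest ∣
  ∎
  where
    rest = unionAll (map tail t)

totalUnion-∷ : ∀ {n} (F : List (Subset (suc n))) k →
  totalUnion F k + count (not ∘ head) F ^ k ≡ length F ^ k + totalUnion (map tail F) k
totalUnion-∷ F k = begin-equality
    totalUnion F k + count (not ∘ head) F ^ k
  ≡⟨ cong (totalUnion F k +_) (sym (∑-tuples-all (not ∘ head) F k)) ⟩
    ∑ (∣_∣ ∘ unionAll) T + ∑ (indicator ∘ all (not ∘ head)) T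
  ≡⟨ sym (∑-+ _ _ T) ⟩
    ∑ (λ t → ∣ unionAll t ∣ + indicator (all (not ∘ head) t)) T
  ≡⟨ ∑-cong T ∣unionAll∣-head ⟩
    ∑ (λ t → 1 + ∣ unionAll (map tail t) ∣) T
  ≡⟨ ∑-+ _ _ T ⟩
    ∑ (λ _ → 1) T + ∑ (∣_∣ ∘ unionAll ∘ map tail) T
  ≡⟨ cong₂ _+_ (trans (∑-1 T) (length-tuples F k)) (sym (∑-map (∣_∣ ∘ unionAll) (map tail) T)) ⟩
    length F ^ k + ∑ (∣_∣ ∘ unionAll) (map (map tail) T)
  ≡⟨ cong (λ T′ → length F ^ k + ∑ (∣_∣ ∘ unionAll) T′) (map-tuples tail F k) ⟩
    length F ^ k + totalUnion (map tail F) k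
  ∎
  where
    T = tuples F k

missing : ∀ {n} → Subset n → Vec ℕ n
missing = Vec.map (indicator ∘ not)

missCounts : ∀ {n} → List (Subset n) → Vec ℕ n
missCounts []      = Vec.replicate _ 0
missCounts (v ∷ F) = zipWith _+_ (missing v) (missCounts F)

missCounts-∷ : ∀ {n} (F : List (Subset (suc n))) → missCounts F ≡ count (not ∘ head) F ∷ missCounts (map tail F)
missCounts-∷ []             = refl
missCounts-∷ ((b ∷ w) ∷ F) = cong (zipWith _+_ (missing (b ∷ w))) (missCounts-∷ F)

powerSum : ∀ {n} → ℕ → Vec ℕ n → ℕ
powerSum k = Vec.sum ∘ Vec.map (_^ k)

totalUnion+powerSum : ∀ n (F : List (Subset n)) k → totalUnion F k + powerSum k (missCounts F) ≡ n * length F ^ k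
totalUnion+powerSum zero F k = begin-equality
    totalUnion F k + powerSum k (missCounts F)   ≡⟨ cong₂ _+_ (∑-cong (tuples F k) (λ t → empty (unionAll t))) (powerSum-[] (missCounts F)) ⟩
    ∑ (λ _ → 0) (tuples F k) + 0                ≡⟨ +-identityʳ _ ⟩
    ∑ (λ _ → 0 * 1) (tuples F k)                ≡⟨ ∑-*ˡ 0 (λ _ → 1) (tuples F k) ⟩
    0                                           ∎
  where
    empty : (p : Subset 0) → ∣ p ∣ ≡ 0
    empty [] = refl
    powerSum-[] : (v : Vec ℕ 0) → powerSum k v ≡ 0
    powerSum-[] [] = refl
totalUnion+powerSum (suc n) F k = begin-equality
    totalUnion F k + powerSum k (missCounts F)
  ≡⟨ cong (λ v → totalUnion F k + powerSum k v) (missCounts-∷ F) ⟩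
    totalUnion F k + (count (not ∘ head) F ^ k + powerSum k (missCounts (map tail F)))
  ≡⟨ sym (+-assoc (totalUnion F k) _ _) ⟩
    totalUnion F k + count (not ∘ head) F ^ k + powerSum k (missCounts (map tail F))
  ≡⟨ cong (_+ powerSum k (missCounts (map tail F))) (totalUnion-∷ F k) ⟩
    length F ^ k + totalUnion (map tail F) k + powerSum k (missCounts (map tail F))
  ≡⟨ +-assoc (length F ^ k) _ _ ⟩
    length F ^ k + (totalUnion (map tail F) k + powerSum k (missCounts (map tail F)))
  ≡⟨ cong (length F ^ k +_) (totalUnion+powerSum n (map tail F) k) ⟩
    length F ^ k + n * length (map tail F) ^ k
  ≡⟨ cong (λ l → length F ^ k + n * l ^ k) (length-map tail F) ⟩
    suc n * length F ^ k
  ∎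

splitByHead : ∀ {n} → List (Subset (suc n)) → List (Subset n) × List (Subset n)
splitByHead []                = [] , []
splitByHead ((true ∷ v) ∷ F)  = map₁ (v ∷_) (splitByHead F)
splitByHead ((false ∷ v) ∷ F) = map₂ (v ∷_) (splitByHead F)

length-splitByHead : ∀ {n} (F : List (Subset (suc n))) →
  length F ≡ length (proj₁ (splitByHead F)) + length (proj₂ (splitByHead F))
length-splitByHead []                = refl
length-splitByHead ((true ∷ v) ∷ F)  = cong suc (length-splitByHead F)
length-splitByHead ((false ∷ v) ∷ F) = trans (cong suc (length-splitByHead F)) (sym (+-suc _ _))

count-not-head : ∀ {n} (F : List (Subset (suc n))) → count (not ∘ head) F ≡ length (proj₂ (splitByHead F))
count-not-head []                = refl
count-not-head ((true ∷ v) ∷ F)  = count-not-head F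
count-not-head ((false ∷ v) ∷ F) = cong suc (count-not-head F)

zipWith-+-swap : ∀ {n} (x y z : Vec ℕ n) → zipWith _+_ x (zipWith _+_ y z) ≡ zipWith _+_ y (zipWith _+_ x z)
zipWith-+-swap []       []       []       = refl
zipWith-+-swap (x ∷ xs) (y ∷ ys) (z ∷ zs) = cong₂ _∷_ (+-CS.x∙yz≈y∙xz x y z) (zipWith-+-swap xs ys zs)

missCounts-splitByHead : ∀ {n} (F : List (Subset (suc n))) →
  missCounts (map tail F) ≡ zipWith _+_ (missCounts (proj₁ (splitByHead F))) (missCounts (proj₂ (splitByHead F)))
missCounts-splitByHead []                = sym (zipWith-identityˡ +-identityˡ (Vec.replicate _ 0))
missCounts-splitByHead ((true ∷ v) ∷ F)  =
  trans (cong (zipWith _+_ (missing v)) (missCounts-splitByHead F)) (sym (zipWith-assoc +-assoc (missing v) _ _))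
missCounts-splitByHead ((false ∷ v) ∷ F) =
  trans (cong (zipWith _+_ (missing v)) (missCounts-splitByHead F)) (zipWith-+-swap (missing v) _ _)

unique-splitByHead : ∀ {n} (F : List (Subset (suc n))) → Unique F →
  Unique (proj₁ (splitByHead F)) × Unique (proj₂ (splitByHead F))
unique-splitByHead []                []       = [] , []
unique-splitByHead ((true ∷ v) ∷ F)  (v∉F ∷ u) = map₁ (distinct v F v∉F ∷_) (unique-splitByHead F u)
  where
    distinct : ∀ v F → All (true ∷ v ≢_) F → All (v ≢_) (proj₁ (splitByHead F))
    distinct v []                []         = []
    distinct v ((true ∷ w) ∷ F)  (≢w ∷ ≢F) = (≢w ∘ cong (true ∷_)) ∷ distinct v F ≢F
    distinct v ((false ∷ w) ∷ F) (_ ∷ ≢F)  = distinct v F ≢F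
unique-splitByHead ((false ∷ v) ∷ F) (v∉F ∷ u) = map₂ (distinct v F v∉F ∷_) (unique-splitByHead F u)
  where
    distinct : ∀ v F → All (false ∷ v ≢_) F → All (v ≢_) (proj₂ (splitByHead F))
    distinct v []                []         = []
    distinct v ((true ∷ w) ∷ F)  (_ ∷ ≢F)  = distinct v F ≢F
    distinct v ((false ∷ w) ∷ F) (≢w ∷ ≢F) = (≢w ∘ cong (false ∷_)) ∷ distinct v F ≢F

power-mean-split : ∀ k a b u v .{{_ : NonZero a}} .{{_ : NonZero b}} →
  (a ^ k * b ^ k) * (u + v) ^ suc k ≤ (a + b) ^ k * (b ^ k * u ^ suc k + a ^ k * v ^ suc k)
power-mean-split k a b u v = *-cancelˡ-≤ (a * b) {{m*n≢0 a b}} (begin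
    a * b * ((A * B) * (u + v) ^ suc k)
  ≡⟨ regroup a b A B ((u + v) ^ suc k) ⟩
    (a * A) * (b * B) * (u + v) ^ suc k
  ≡⟨ trans (cong (_* (u + v) ^ suc k) (sym (^-distribʳ-* a b (suc k)))) (sym (^-distribʳ-* (a * b) (u + v) (suc k))) ⟩
    (a * b * (u + v)) ^ suc k
  ≡⟨ cong (_^ suc k) (weights a b u v) ⟩
    (a * (u * b) + b * (v * a)) ^ suc k
  ≤⟨ power-mean k a b (u * b) (v * a) ⟩
    (a + b) ^ k * (a * (u * b) ^ suc k + b * (v * a) ^ suc k)
  ≡⟨ cong (λ z → (a + b) ^ k * z) (cong₂ (λ p q → a * p + b * q) (^-distribʳ-* u b (suc k)) (^-distribʳ-* v a (suc k))) ⟩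
    (a + b) ^ k * (a * (u ^ suc k * (b * B)) + b * (v ^ suc k * (a * A)))
  ≡⟨ collect a b ((a + b) ^ k) (u ^ suc k) (v ^ suc k) A B ⟩
    a * b * ((a + b) ^ k * (B * u ^ suc k + A * v ^ suc k))
  ∎)
  where
    A = a ^ k
    B = b ^ k
    regroup : ∀ a b A B X → a * b * ((A * B) * X) ≡ (a * A) * (b * B) * X
    regroup = solve-∀
    weights : ∀ a b u v → a * b * (u + v) ≡ a * (u * b) + b * (v * a)
    weights = solve-∀
    collect : ∀ a b M U V A B → M * (a * (U * (b * B)) + b * (V * (a * A))) ≡ a * b * (M * (B * U + A * V))
    collect = solve-∀

powerSum-power-mean : ∀ {n} k a b (U V : Vec ℕ n) .{{_ : NonZero a}} .{{_ : NonZero b}} →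
  (a ^ k * b ^ k) * powerSum (suc k) (zipWith _+_ U V) ≤ (a + b) ^ k * (b ^ k * powerSum (suc k) U + a ^ k * powerSum (suc k) V)
powerSum-power-mean k a b []       []       = ≤-trans (≤-reflexive (*-zeroʳ (a ^ k * b ^ k))) z≤n
powerSum-power-mean k a b (u ∷ U) (v ∷ V) = begin
    D * ((u + v) ^ suc k + powerSum (suc k) (zipWith _+_ U V))
  ≡⟨ *-distribˡ-+ D _ _ ⟩
    D * (u + v) ^ suc k + D * powerSum (suc k) (zipWith _+_ U V)
  ≤⟨ +-mono-≤ (power-mean-split k a b u v) (powerSum-power-mean k a b U V) ⟩
    M * (B * u ^ suc k + A * v ^ suc k) + M * (B * powerSum (suc k) U + A * powerSum (suc k) V)
  ≡⟨ collect M B A (u ^ suc k) (v ^ suc k) (powerSum (suc k) U) (powerSum (suc k) V) ⟩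
    M * (B * (u ^ suc k + powerSum (suc k) U) + A * (v ^ suc k + powerSum (suc k) V))
  ∎
  where
    A = a ^ k
    B = b ^ k
    D = A * B
    M = (a + b) ^ k
    collect : ∀ M B A u v U V → M * (B * u + A * v) + M * (B * U + A * V) ≡ M * (B * (u + U) + A * (v + V))
    collect = solve-∀

-- The chain rule for entropy, exponentiated: the entropy bound for the split m = a + b, the bounds
-- for the two parts and the convexity estimate add up to the bound for the whole family.
chain-rule : ∀ a b n K C A′ B′ M′ SU SV SW .{{_ : NonZero a}} .{{_ : NonZero b}} .{{_ : NonZero A′}} .{{_ : NonZero B′}} →
  let m = a + b in
  (m ^ m) ^ (K * (m * M′)) * 2 ^ (K * m * (b * B′)) ≤ (a ^ a * b ^ b) ^ (K * (m * M′)) * 2 ^ ((K + C) * (m * (m * M′))) →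
  a ^ (K * (a * A′)) * 2 ^ (K * SU) ≤ 2 ^ ((K + C) * (n * (a * A′))) →
  b ^ (K * (b * B′)) * 2 ^ (K * SV) ≤ 2 ^ ((K + C) * (n * (b * B′))) →
  (A′ * B′) * SW ≤ M′ * (B′ * SU + A′ * SV) →
  m ^ (K * (m * M′)) * 2 ^ (K * (b * B′ + SW)) ≤ 2 ^ ((K + C) * (suc n * (m * M′)))
chain-rule a b n K C A′ B′ M′ SU SV SW entropy bound-a bound-b convexity =
  ^-cancelˡ-≤ (m * D) {{m*n≢0 m D {{m+n≢0 a b}} {{m*n≢0 A′ B′}}}} (*-cancelʳ-≤ _ _ (Aa * Bb) {{Aa*Bb≢0}} (begin
    LHS ^ (m * D) * (Aa * Bb)
      ≡⟨ cong (_* (Aa * Bb)) LHS^mD≡ ⟩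
    ((m ^ m) ^ (K * Mk) * 2 ^ (K * m * Bk)) ^ D * 2 ^ (K * m * D * SW) * (Aa * Bb)
      ≤⟨ *-monoˡ-≤ (Aa * Bb) (*-mono-≤ (^-monoˡ-≤ D entropy) (^-monoʳ-≤ 2 convexity′)) ⟩
    ((a ^ a * b ^ b) ^ (K * Mk) * 2 ^ ((K + C) * (m * Mk))) ^ D * 2 ^ (K * Mk * (B′ * SU + A′ * SV)) * (Aa * Bb)
      ≡⟨ split-parts ⟩
    (Aa * Bb) * (GA ^ Pa * GB ^ Pb * Tail)
      ≤⟨ *-monoʳ-≤ (Aa * Bb) (*-monoˡ-≤ Tail (*-mono-≤ (^-monoˡ-≤ Pa bound-a) (^-monoˡ-≤ Pb bound-b))) ⟩
    (Aa * Bb) * ((2 ^ ((K + C) * (n * Ak))) ^ Pa * (2 ^ ((K + C) * (n * Bk))) ^ Pb * Tail)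
      ≡⟨ cong ((Aa * Bb) *_) RHS^mD≡ ⟩
    (Aa * Bb) * RHS ^ (m * D)
      ≡⟨ *-comm (Aa * Bb) _ ⟩
    RHS ^ (m * D) * (Aa * Bb) ∎))
  where
    m = a + b
    Mk = m * M′
    Ak = a * A′
    Bk = b * B′
    D = A′ * B′
    Aa = (a ^ a) ^ (K * Mk * D)
    Bb = (b ^ b) ^ (K * Mk * D)
    LHS = m ^ (K * Mk) * 2 ^ (K * (Bk + SW))
    RHS = 2 ^ ((K + C) * (suc n * Mk))
    GA = a ^ (K * Ak) * 2 ^ (K * SU)
    GB = b ^ (K * Bk) * 2 ^ (K * SV)
    Pa = Mk * B′
    Pb = Mk * A′
    Tail = 2 ^ ((K + C) * (m * Mk) * D)
    Aa*Bb≢0 : NonZero (Aa * Bb)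
    Aa*Bb≢0 = m*n≢0 Aa Bb {{m^n≢0 (a ^ a) (K * Mk * D) {{m^n≢0 a a}}}} {{m^n≢0 (b ^ b) (K * Mk * D) {{m^n≢0 b b}}}}
    LHS^mD≡ : LHS ^ (m * D) ≡ ((m ^ m) ^ (K * Mk) * 2 ^ (K * m * Bk)) ^ D * 2 ^ (K * m * D * SW)
    LHS^mD≡ = begin-equality
        (m ^ (K * Mk) * 2 ^ (K * (Bk + SW))) ^ (m * D)
      ≡⟨ ^-distribʳ-* (m ^ (K * Mk)) (2 ^ (K * (Bk + SW))) (m * D) ⟩
        (m ^ (K * Mk)) ^ (m * D) * (2 ^ (K * (Bk + SW))) ^ (m * D)
      ≡⟨ cong₂ _*_ (trans (^-^-reassoc m (K * Mk) (m * D) m (K * Mk * D) (swap K Mk m D)) (sym (^-*-assoc (m ^ m) (K * Mk) D)))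
                   (trans (^-*-assoc 2 (K * (Bk + SW)) (m * D))
                          (trans (cong (2 ^_) (spread K Bk SW m D)) (^-distribˡ-+-* 2 (K * m * Bk * D) (K * m * D * SW)))) ⟩
        ((m ^ m) ^ (K * Mk)) ^ D * (2 ^ (K * m * Bk * D) * 2 ^ (K * m * D * SW))
      ≡⟨ sym (*-assoc (((m ^ m) ^ (K * Mk)) ^ D) _ _) ⟩
        ((m ^ m) ^ (K * Mk)) ^ D * 2 ^ (K * m * Bk * D) * 2 ^ (K * m * D * SW)
      ≡⟨ cong (_* 2 ^ (K * m * D * SW)) (trans (cong (((m ^ m) ^ (K * Mk)) ^ D *_) (sym (^-*-assoc 2 (K * m * Bk) D)))
                                               (sym (^-distribʳ-* ((m ^ m) ^ (K * Mk)) (2 ^ (K * m * Bk)) D))) ⟩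
        ((m ^ m) ^ (K * Mk) * 2 ^ (K * m * Bk)) ^ D * 2 ^ (K * m * D * SW)
      ∎
      where
        swap : ∀ K Mk m D → K * Mk * (m * D) ≡ m * (K * Mk * D)
        swap = solve-∀
        spread : ∀ K Bk SW m D → K * (Bk + SW) * (m * D) ≡ K * m * Bk * D + K * m * D * SW
        spread = solve-∀
    convexity′ : K * m * D * SW ≤ K * Mk * (B′ * SU + A′ * SV)
    convexity′ = begin
      K * m * D * SW                      ≡⟨ *-assoc (K * m) D SW ⟩
      K * m * (D * SW)                    ≤⟨ *-monoʳ-≤ (K * m) convexity ⟩
      K * m * (M′ * (B′ * SU + A′ * SV))  ≡⟨ reassoc K m M′ (B′ * SU + A′ * SV) ⟩
      K * Mk * (B′ * SU + A′ * SV)        ∎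
      where
        reassoc : ∀ K m M X → K * m * (M * X) ≡ K * (m * M) * X
        reassoc = solve-∀
    split-parts : ((a ^ a * b ^ b) ^ (K * Mk) * 2 ^ ((K + C) * (m * Mk))) ^ D * 2 ^ (K * Mk * (B′ * SU + A′ * SV)) * (Aa * Bb)
                  ≡ (Aa * Bb) * (GA ^ Pa * GB ^ Pb * Tail)
    split-parts = begin-equality
        ((a ^ a * b ^ b) ^ (K * Mk) * 2 ^ ((K + C) * (m * Mk))) ^ D * 2 ^ (K * Mk * (B′ * SU + A′ * SV)) * (Aa * Bb)
      ≡⟨ cong (λ z → z * 2 ^ (K * Mk * (B′ * SU + A′ * SV)) * (Aa * Bb))
           (trans (^-distribʳ-* _ _ D) (cong₂ _*_ (trans (^-*-assoc _ (K * Mk) D) (^-distribʳ-* (a ^ a) (b ^ b) (K * Mk * D)))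
                                                  (^-*-assoc 2 ((K + C) * (m * Mk)) D))) ⟩
        Aa * Bb * Tail * 2 ^ (K * Mk * (B′ * SU + A′ * SV)) * (Aa * Bb)
      ≡⟨ cong (λ z → Aa * Bb * Tail * z * (Aa * Bb))
              (trans (cong (2 ^_) (distribute K Mk B′ SU A′ SV)) (^-distribˡ-+-* 2 (K * SU * Pa) (K * SV * Pb))) ⟩
        Aa * Bb * Tail * (2 ^ (K * SU * Pa) * 2 ^ (K * SV * Pb)) * (Aa * Bb)
      ≡⟨ regroup (Aa * Bb) Aa Bb Tail (2 ^ (K * SU * Pa)) (2 ^ (K * SV * Pb)) ⟩
        (Aa * Bb) * ((Aa * 2 ^ (K * SU * Pa)) * (Bb * 2 ^ (K * SV * Pb)) * Tail)
      ≡⟨ cong ((Aa * Bb) *_) (cong₂ (λ u v → u * v * Tail) (sym GA^Pa≡) (sym GB^Pb≡)) ⟩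
        (Aa * Bb) * (GA ^ Pa * GB ^ Pb * Tail)
      ∎
      where
        distribute : ∀ K Mk B′ SU A′ SV → K * Mk * (B′ * SU + A′ * SV) ≡ K * SU * (Mk * B′) + K * SV * (Mk * A′)
        distribute = solve-∀
        regroup : ∀ P A B T X Y → A * B * T * (X * Y) * P ≡ P * ((A * X) * (B * Y) * T)
        regroup = solve-∀
        exponent : ∀ K c X Y Mk → K * (c * X) * (Mk * Y) ≡ c * (K * Mk * (X * Y))
        exponent = solve-∀
        part : ∀ c X Y S → K * (c * X) * (Mk * Y) ≡ c * (K * Mk * D) →
               (c ^ (K * (c * X)) * 2 ^ (K * S)) ^ (Mk * Y) ≡ (c ^ c) ^ (K * Mk * D) * 2 ^ (K * S * (Mk * Y))
        part c X Y S eq = trans (^-distribʳ-* (c ^ (K * (c * X))) (2 ^ (K * S)) (Mk * Y))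
                                (cong₂ _*_ (^-^-reassoc c (K * (c * X)) (Mk * Y) c _ eq) (^-*-assoc 2 (K * S) (Mk * Y)))
        GA^Pa≡ : GA ^ Pa ≡ Aa * 2 ^ (K * SU * Pa)
        GA^Pa≡ = part a A′ B′ SU (exponent K a A′ B′ Mk)
        GB^Pb≡ : GB ^ Pb ≡ Bb * 2 ^ (K * SV * Pb)
        GB^Pb≡ = part b B′ A′ SV (trans (exponent K b B′ A′ Mk) (cong (λ z → b * (K * Mk * z)) (*-comm B′ A′)))
    RHS^mD≡ : (2 ^ ((K + C) * (n * Ak))) ^ Pa * (2 ^ ((K + C) * (n * Bk))) ^ Pb * Tail ≡ RHS ^ (m * D)
    RHS^mD≡ = begin-equality
        (2 ^ ((K + C) * (n * Ak))) ^ Pa * (2 ^ ((K + C) * (n * Bk))) ^ Pb * Tail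
      ≡⟨ cong (_* Tail) (trans (cong₂ _*_ (^-*-assoc 2 ((K + C) * (n * Ak)) Pa) (^-*-assoc 2 ((K + C) * (n * Bk)) Pb))
                               (sym (^-distribˡ-+-* 2 ((K + C) * (n * Ak) * Pa) ((K + C) * (n * Bk) * Pb)))) ⟩
        2 ^ ((K + C) * (n * Ak) * Pa + (K + C) * (n * Bk) * Pb) * Tail
      ≡⟨ sym (^-distribˡ-+-* 2 ((K + C) * (n * Ak) * Pa + (K + C) * (n * Bk) * Pb) ((K + C) * (m * Mk) * D)) ⟩
        2 ^ ((K + C) * (n * Ak) * Pa + (K + C) * (n * Bk) * Pb + (K + C) * (m * Mk) * D)
      ≡⟨ cong (2 ^_) (collect K C n a A′ b B′ M′) ⟩
        2 ^ ((K + C) * (suc n * Mk) * (m * D))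
      ≡⟨ sym (^-*-assoc 2 ((K + C) * (suc n * Mk)) (m * D)) ⟩
        RHS ^ (m * D)
      ∎
      where
        collect : ∀ K C n a A′ b B′ M′ →
          (K + C) * (n * (a * A′)) * ((a + b) * M′ * B′) + (K + C) * (n * (b * B′)) * ((a + b) * M′ * A′)
            + (K + C) * ((a + b) * ((a + b) * M′)) * (A′ * B′)
          ≡ (K + C) * (suc n * ((a + b) * M′)) * ((a + b) * (A′ * B′))
        collect = solve-∀

-- In logarithms: log₂ m ≤ n (1 + C / 2 ^ k) - S / m ^ k.
SizeBound : ℕ → ℕ → ℕ → ℕ → Set
SizeBound k n m S = m ^ (2 ^ k * m ^ k) * 2 ^ (2 ^ k * S) ≤ 2 ^ ((2 ^ k + C) * (n * m ^ k))

sizeBound-weaken : ∀ k n m S → SizeBound k n m S → SizeBound k (suc n) m S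
sizeBound-weaken k n m S bound = ≤-trans bound (^-monoʳ-≤ 2 (*-monoʳ-≤ (2 ^ k + C) (*-monoˡ-≤ (m ^ k) (n≤1+n n))))

sizeBound-missing : ∀ k n m S → SizeBound k n m S → SizeBound k (suc n) m (m ^ k + S)
sizeBound-missing k n m S bound = begin
    m ^ (K * m ^ k) * 2 ^ (K * (m ^ k + S))             ≡⟨ cong (λ e → m ^ (K * m ^ k) * 2 ^ e) (spread K (m ^ k) S) ⟩
    m ^ (K * m ^ k) * 2 ^ (K * S + K * m ^ k)           ≡⟨ cong (m ^ (K * m ^ k) *_) (^-distribˡ-+-* 2 (K * S) (K * m ^ k)) ⟩
    m ^ (K * m ^ k) * (2 ^ (K * S) * 2 ^ (K * m ^ k))   ≡⟨ sym (*-assoc (m ^ (K * m ^ k)) _ _) ⟩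
    m ^ (K * m ^ k) * 2 ^ (K * S) * 2 ^ (K * m ^ k)     ≤⟨ *-monoˡ-≤ (2 ^ (K * m ^ k)) bound ⟩
    2 ^ ((K + C) * (n * m ^ k)) * 2 ^ (K * m ^ k)       ≡⟨ sym (^-distribˡ-+-* 2 ((K + C) * (n * m ^ k)) (K * m ^ k)) ⟩
    2 ^ ((K + C) * (n * m ^ k) + K * m ^ k)             ≤⟨ ^-monoʳ-≤ 2 (+-monoʳ-≤ ((K + C) * (n * m ^ k)) (*-monoˡ-≤ (m ^ k) (m≤m+n K C))) ⟩
    2 ^ ((K + C) * (n * m ^ k) + (K + C) * m ^ k)       ≡⟨ cong (2 ^_) (collect (K + C) n (m ^ k)) ⟩
    2 ^ ((K + C) * (suc n * m ^ k))                     ∎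
  where
    K = 2 ^ k
    spread : ∀ K M S → K * (M + S) ≡ K * S + K * M
    spread = solve-∀
    collect : ∀ c n M → c * (n * M) + c * M ≡ c * (suc n * M)
    collect = solve-∀

sizeBound-step : ∀ k n a b (U V : Vec ℕ n) →
  SizeBound (suc k) n a (powerSum (suc k) U) → SizeBound (suc k) n b (powerSum (suc k) V) →
  (a ≡ 0 → U ≡ Vec.replicate n 0) → (b ≡ 0 → V ≡ Vec.replicate n 0) →
  SizeBound (suc k) (suc n) (a + b) (b ^ suc k + powerSum (suc k) (zipWith _+_ U V))
sizeBound-step k n zero b U V _ bound-b U≡0 _ =
  subst (λ W → SizeBound (suc k) (suc n) b (b ^ suc k + powerSum (suc k) W)) (sym U+V≡V)
    (sizeBound-missing (suc k) n b _ bound-b)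
  where
    U+V≡V : zipWith _+_ U V ≡ V
    U+V≡V = trans (cong (λ W → zipWith _+_ W V) (U≡0 refl)) (zipWith-identityˡ +-identityˡ V)
sizeBound-step k n a@(suc _) zero U V bound-a _ _ V≡0 =
  subst₂ (λ m W → SizeBound (suc k) (suc n) m (powerSum (suc k) W)) (sym (+-identityʳ a)) (sym U+V≡U)
    (sizeBound-weaken (suc k) n a _ bound-a)
  where
    U+V≡U : zipWith _+_ U V ≡ U
    U+V≡U = trans (cong (zipWith _+_ U) (V≡0 refl)) (zipWith-identityʳ +-identityʳ U)
sizeBound-step k n a@(suc _) b@(suc _) U V bound-a bound-b _ _ =
  chain-rule a b n (2 ^ suc k) C (a ^ k) (b ^ k) ((a + b) ^ k) (powerSum (suc k) U) (powerSum (suc k) V) _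
    (entropyBound (suc k) a b) bound-a bound-b (powerSum-power-mean k a b U V)
  where
    instance
      a^k≢0 : NonZero (a ^ k)
      a^k≢0 = m^n≢0 a k
      b^k≢0 : NonZero (b ^ k)
      b^k≢0 = m^n≢0 b k

length≤1 : (F : List (Subset 0)) → Unique F → length F ≤ 1
length≤1 []                   _                  = z≤n
length≤1 (_ ∷ [])             _                  = s≤s z≤n
length≤1 ([] ∷ [] ∷ _)        ((≢ ∷ _) ∷ _)      = ⊥-elim (≢ refl)

sizeBound : ∀ k n (F : List (Subset n)) → Unique F → SizeBound (suc k) n (length F) (powerSum (suc k) (missCounts F))
sizeBound k zero F unique = begin
    length F ^ (K * length F ^ suc k) * 2 ^ (K * powerSum (suc k) (missCounts F))
      ≡⟨ cong (λ S → length F ^ (K * length F ^ suc k) * 2 ^ (K * S)) (empty (missCounts F)) ⟩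
    length F ^ (K * length F ^ suc k) * 2 ^ (K * 0)
      ≡⟨ cong (λ e → length F ^ (K * length F ^ suc k) * 2 ^ e) (*-zeroʳ K) ⟩
    length F ^ (K * length F ^ suc k) * 1
      ≤⟨ *-monoˡ-≤ 1 (≤-trans (^-monoˡ-≤ (K * length F ^ suc k) (length≤1 F unique)) (≤-reflexive (^-zeroˡ (K * length F ^ suc k)))) ⟩
    1 * 1
      ≤⟨ m^n>0 2 ((K + C) * (0 * length F ^ suc k)) ⟩
    2 ^ ((K + C) * (0 * length F ^ suc k)) ∎
  where
    K = 2 ^ suc k
    empty : (v : Vec ℕ 0) → powerSum (suc k) v ≡ 0
    empty [] = refl
sizeBound k (suc n) F unique =
  subst₂ (λ m S → SizeBound (suc k) (suc n) m S) (sym (length-splitByHead F)) (sym missCounts≡)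
    (sizeBound-step k n (length F₁) (length F₀) (missCounts F₁) (missCounts F₀)
      (sizeBound k n F₁ (proj₁ (unique-splitByHead F unique))) (sizeBound k n F₀ (proj₂ (unique-splitByHead F unique)))
      (empty F₁) (empty F₀))
  where
    F₁ = proj₁ (splitByHead F)
    F₀ = proj₂ (splitByHead F)
    empty : (G : List (Subset n)) → length G ≡ 0 → missCounts G ≡ Vec.replicate n 0
    empty [] _ = refl
    missCounts≡ : powerSum (suc k) (missCounts F) ≡ length F₀ ^ suc k + powerSum (suc k) (zipWith _+_ (missCounts F₁) (missCounts F₀))
    missCounts≡ = trans (cong (powerSum (suc k)) (missCounts-∷ F))
                        (cong₂ (λ c v → c ^ suc k + powerSum (suc k) v) (count-not-head F) (missCounts-splitByHead F))

union-bound : ∀ n k → 1 ≤ k → (F : List (Subset n)) → Unique F →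
  length F ^ (length F ^ k * 2 ^ k) ≤ 2 ^ (totalUnion F k * 2 ^ k + C * n * length F ^ k)
union-bound n k@(suc k′) _ F unique = *-cancelʳ-≤ _ _ (2 ^ (K * S)) {{m^n≢0 2 (K * S)}} (begin
    m ^ (m ^ k * K) * 2 ^ (K * S)          ≡⟨ cong (λ e → m ^ e * 2 ^ (K * S)) (*-comm (m ^ k) K) ⟩
    m ^ (K * m ^ k) * 2 ^ (K * S)          ≤⟨ sizeBound k′ n F unique ⟩
    2 ^ ((K + C) * (n * m ^ k))            ≡⟨ cong (2 ^_) (rearrange K C T S n (m ^ k) (totalUnion+powerSum n F k)) ⟩
    2 ^ ((T * K + C * n * m ^ k) + K * S)  ≡⟨ ^-distribˡ-+-* 2 (T * K + C * n * m ^ k) (K * S) ⟩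
    2 ^ (T * K + C * n * m ^ k) * 2 ^ (K * S) ∎)
  where
    K = 2 ^ k
    m = length F
    T = totalUnion F k
    S = powerSum k (missCounts F)
    rearrange : ∀ K c T S n M → T + S ≡ n * M → (K + c) * (n * M) ≡ (T * K + c * n * M) + K * S
    rearrange K c T S n M T+S≡nM = begin-equality
      (K + c) * (n * M)              ≡⟨ *-distribʳ-+ (n * M) K c ⟩
      K * (n * M) + c * (n * M)      ≡⟨ cong (λ z → K * z + c * (n * M)) (sym T+S≡nM) ⟩
      K * (T + S) + c * (n * M)      ≡⟨ regroup K c T S n M ⟩
      (T * K + c * n * M) + K * S    ∎
      where
        regroup : ∀ K c T S n M → K * (T + S) + c * (n * M) ≡ (T * K + c * n * M) + K * S
        regroup = solve-∀

lemma3p5 : Σ ℕ (λ C → 0 < C ×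
             ((n k : ℕ) → 1 ≤ n → 1 ≤ k →
              (𝓕 : List (Subset n)) → Unique 𝓕 → 1 ≤ length 𝓕 →
              length 𝓕 ^ (length 𝓕 ^ k * 2 ^ k)
                ≤ 2 ^ (totalUnion 𝓕 k * 2 ^ k + C * n * length 𝓕 ^ k)))
lemma3p5 = C , ≤-trans (s≤s z≤n) 2≤C , λ n k _ 1≤k 𝓕 unique _ → union-bound n k 1≤k 𝓕 unique
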